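{- Let $A$ be an abelian group of order $v\equiv 2$ or $4\pmod 6$, and let $\omega_1=|\{a\in A:2a=0\}|$ and $\omega_2=|\{a\in A:4a=0\}|$. Then the number of $3$-subsets $T$ of $A$ whose $\hat A$-orbit lies in $\mathcal T_1\cup\mathcal T_2$ is $$\frac12 v^2\omega_1-\frac16 v(2\omega_1^2+3\omega_2-2).$$
   Context: For a finite abelian group $A$ (additive), $\hat A$ is the permutation group on $A$ generated by translations $x\mapsto x+a$ and $x\mapsto -x$; the $\hat A$-orbit of $X$ is $\{X+c\}_{c\in A}\cup\{ -X+c\}_{c\in A}$, and $[a_1,\dots,a_t]$ denotes the $\hat A$-orbit of $\{0,a_1,\dots,a_t\}$. $\Omega_1(A)=\{a: 2a=0\}$. $\mathcal T_1=\{[a,-a]: a\in A\setminus\Omega_1(A)\}$, $\mathcal T_2=\{[a,h]: a\in A\setminus\{0\},\ h\in\Omega_1(A)\setminus\{0,a\}\}$. -}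

module Defs where

open import Level using (0ℓ)
open import Data.Nat using (ℕ)
open import Data.Fin using (Fin)
open import Data.Fin.Subset using (Subset; _∈_)
open import Data.List using (List; length)
open import Data.List.Relation.Unary.Unique.Propositional using (Unique)
open import Data.List.Relation.Unary.Any using (Any)
import Data.List.Membership.Propositional as LM
open import Data.Product using (Σ; ∃; ∃-syntax; _×_)
open import Data.Sum using (_⊎_)
open import Relation.Binary.PropositionalEquality using (_≡_)
open import Relation.Nullary using (¬_)
open import Function.Bundles using (_↔_; _⇔_; Inverse)
open import Algebra.Structures using (IsAbelianGroup)

record FinAbGroup : Set₁ where
  field
    Carrier : Set
    _+_     : Carrier → Carrier → Carrier
    0#      : Carrier
    -_      : Carrier → Carrier
    isAbelianGroup : IsAbelianGroup _≡_ _+_ 0# -_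
    order   : ℕ
    enum    : Carrier ↔ Fin order

  infixl 6 _+_
  infix 8 -_

  SubsetA : Set
  SubsetA = Subset order

  _∈A_ : Carrier → SubsetA → Set
  x ∈A T = Inverse.to enum x ∈ T

  -- the ÂA-orbit of X = {elements of xs}: T lies in it iff T = X + c or T = -X + c
  InOrbit : SubsetA → List Carrier → Set
  InOrbit T xs = ∃[ c ]
      ((∀ x → x ∈A T ⇔ Any (λ y → x ≡ y + c) xs)
    ⊎ (∀ x → x ∈A T ⇔ Any (λ y → x ≡ - y + c) xs))

  open Data.List using ([]; _∷_)

  InT1 : SubsetA → Set
  InT1 T = ∃[ a ] (¬ (a + a ≡ 0#) × InOrbit T (0# ∷ a ∷ - a ∷ []))

  InT2 : SubsetA → Set
  InT2 T = ∃[ a ] ∃[ h ] (¬ (a ≡ 0#) × (h + h ≡ 0#) × ¬ (h ≡ 0#) × ¬ (h ≡ a)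
                          × InOrbit T (0# ∷ a ∷ h ∷ []))

HasSize : {X : Set} → ℕ → (X → Set) → Set
HasSize {X} n P = Σ (List X) λ L → Unique L × (∀ x → x LM.∈ L ⇔ P x) × length L ≡ n

module Submission where

-- Since the elements are distinct, a 3-subset {x, y, z} is a translate of some [a, −a] exactly when
-- one of its elements is the midpoint of the other two, and of some [a, h] exactly when two of its
-- elements differ by a nonzero element of Ω₁.  Hence 6N counts the ordered triples of distinct
-- elements with this property.  The property is translation invariant, so that count is v times the
-- number of pairs (y, z) completing 0 to such a triple.  As 3 ∤ v, A has no element of order 3, and
-- these pairs fall into six disjoint classes, of sizes (ω₁ − 1)(v − 2), twice (v − ω₁)(ω₁ − 1) and
-- three times v − ω₂; the formula follows.

open import Defs
open import Data.Nat using (ℕ)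
open import Data.Fin using (Fin)
open import Function.Bundles using (_↔_)

module Indicator where
  open import Data.Nat using (ℕ; _+_; _*_)
  open import Data.Product using (_×_; _,_)
  open import Data.Empty using (⊥-elim)
  open import Relation.Nullary using (¬_; Dec; yes; no; ¬?)
  open import Relation.Nullary.Decidable using (_×-dec_; _⊎-dec_)
  open import Relation.Binary.PropositionalEquality using (_≡_; refl; cong)

  𝟙 : ∀ {p} {P : Set p} → Dec P → ℕ
  𝟙 (yes _) = 1
  𝟙 (no _)  = 0

  module _ {p} {P : Set p} where
    𝟙-yes : P → (dp : Dec P) → 𝟙 dp ≡ 1
    𝟙-yes _ (yes _) = refl
    𝟙-yes p (no ¬p) = ⊥-elim (¬p p)

    𝟙-no : ¬ P → (dp : Dec P) → 𝟙 dp ≡ 0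
    𝟙-no ¬p (yes p) = ⊥-elim (¬p p)
    𝟙-no _  (no _)  = refl

    𝟙-*-cong : ∀ {m k} (dp : Dec P) → (P → m ≡ k) → 𝟙 dp * m ≡ 𝟙 dp * k
    𝟙-*-cong (yes p) m≡k = cong (1 *_) (m≡k p)
    𝟙-*-cong (no _)  _   = refl

    𝟙-¬ : (dp : Dec P) → 𝟙 dp + 𝟙 (¬? dp) ≡ 1
    𝟙-¬ (yes _) = refl
    𝟙-¬ (no _)  = refl

  module _ {p q} {P : Set p} {Q : Set q} where
    𝟙-cong : (P → Q) → (Q → P) → (dp : Dec P) (dq : Dec Q) → 𝟙 dp ≡ 𝟙 dq
    𝟙-cong _ _ (yes _) (yes _) = refl
    𝟙-cong f _ (yes p) (no ¬q) = ⊥-elim (¬q (f p))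
    𝟙-cong _ g (no ¬p) (yes q) = ⊥-elim (¬p (g q))
    𝟙-cong _ _ (no _)  (no _)  = refl

    𝟙-× : (dp : Dec P) (dq : Dec Q) → 𝟙 (dp ×-dec dq) ≡ 𝟙 dp * 𝟙 dq
    𝟙-× (yes _) (yes _) = refl
    𝟙-× (yes _) (no _)  = refl
    𝟙-× (no _)  _       = refl

    𝟙-⊎ : ¬ (P × Q) → (dp : Dec P) (dq : Dec Q) → 𝟙 (dp ⊎-dec dq) ≡ 𝟙 dp + 𝟙 dq
    𝟙-⊎ disj (yes p) (yes q) = ⊥-elim (disj (p , q))
    𝟙-⊎ _    (yes _) (no _)  = refl
    𝟙-⊎ _    (no _)  (yes _) = refl
    𝟙-⊎ _    (no _)  (no _)  = refl

module ListSum {A : Set} where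
  open import Data.Nat using (ℕ; suc; _+_; _*_)
  open import Data.Nat.Properties using (*-distribʳ-+)
  open import Data.Nat.ListAction using (sum)
  open import Data.List using (List; []; _∷_; map; filter; length)
  open import Data.List.Membership.Propositional using (_∈_; _∉_)
  open import Data.List.Relation.Unary.Any using (here; there)
  open import Data.List.Relation.Unary.All using (lookup)
  open import Data.List.Relation.Unary.AllPairs using (_∷_)
  open import Data.List.Relation.Unary.Unique.Propositional using (Unique)
  open import Relation.Nullary using (yes; no)
  open import Relation.Unary using (Pred; Decidable)
  open import Relation.Binary using (DecidableEquality)
  open import Relation.Binary.PropositionalEquality using (_≡_; refl; sym; trans; cong; cong₂)
  open Indicator

  ∑ˡ : List A → (A → ℕ) → ℕ
  ∑ˡ xs f = sum (map f xs)

  ∑ˡ-cong : ∀ xs {f g : A → ℕ} → (∀ x → f x ≡ g x) → ∑ˡ xs f ≡ ∑ˡ xs g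
  ∑ˡ-cong []       f≗g = refl
  ∑ˡ-cong (x ∷ xs) f≗g = cong₂ _+_ (f≗g x) (∑ˡ-cong xs f≗g)

  ∑ˡ-*ʳ : ∀ xs c (f : A → ℕ) → ∑ˡ xs (λ x → f x * c) ≡ ∑ˡ xs f * c
  ∑ˡ-*ʳ []       c f = refl
  ∑ˡ-*ʳ (x ∷ xs) c f = trans (cong (f x * c +_) (∑ˡ-*ʳ xs c f)) (sym (*-distribʳ-+ c (f x) (∑ˡ xs f)))

  length-filter≡∑ˡ : ∀ {p} {P : Pred A p} (P? : Decidable P) xs → length (filter P? xs) ≡ ∑ˡ xs (λ x → 𝟙 (P? x))
  length-filter≡∑ˡ P? []       = refl
  length-filter≡∑ˡ P? (x ∷ xs) with P? x
  ... | yes _ = cong suc (length-filter≡∑ˡ P? xs)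
  ... | no _  = length-filter≡∑ˡ P? xs

  module _ (_≟_ : DecidableEquality A) where
    ∑ˡ-δ-∉ : ∀ {x} xs → x ∉ xs → ∑ˡ xs (λ y → 𝟙 (x ≟ y)) ≡ 0
    ∑ˡ-δ-∉ []       _   = refl
    ∑ˡ-δ-∉ (y ∷ xs) x∉ = cong₂ _+_ (𝟙-no (λ x≡y → x∉ (here x≡y)) _) (∑ˡ-δ-∉ xs (λ x∈ → x∉ (there x∈)))

    ∑ˡ-δ-∈ : ∀ {x xs} → Unique xs → x ∈ xs → ∑ˡ xs (λ y → 𝟙 (x ≟ y)) ≡ 1
    ∑ˡ-δ-∈ {xs = y ∷ xs} (y∉ ∷ _) (here refl) =
      cong₂ _+_ (𝟙-yes refl (y ≟ y)) (∑ˡ-δ-∉ xs (λ y∈ → lookup y∉ y∈ refl))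
    ∑ˡ-δ-∈ {x} {y ∷ xs} (y∉ ∷ u) (there x∈) =
      cong₂ _+_ (𝟙-no (λ x≡y → lookup y∉ x∈ (sym x≡y)) (x ≟ y)) (∑ˡ-δ-∈ u x∈)

  ∑ˡ-const-1 : ∀ xs → ∑ˡ xs (λ _ → 1) ≡ length xs
  ∑ˡ-const-1 []       = refl
  ∑ˡ-const-1 (x ∷ xs) = cong suc (∑ˡ-const-1 xs)

module FinSubset where
  open import Data.Nat using (suc)
  open import Data.Fin using (suc)
  open import Data.Fin.Subset using (Subset; inside; outside; ∣_∣)
  open import Data.Fin.Subset.Properties using (_∈?_; drop-there)
  open import Data.Vec using (_∷_; []; there)
  open import Data.Nat.Properties using (+-*-semiring)
  open import Algebra.Properties.Semiring.Sum +-*-semiring using (sum; sum-cong-≗)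
  open import Relation.Binary.PropositionalEquality using (_≡_; refl; trans; cong)
  open Indicator

  sum-∈≡∣∣ : ∀ {n} (T : Subset n) → sum (λ i → 𝟙 (i ∈? T)) ≡ ∣ T ∣
  sum-∈≡∣∣ []            = refl
  sum-∈≡∣∣ (outside ∷ T) = trans (sum-cong-≗ (λ i → 𝟙-cong drop-there there (suc i ∈? outside ∷ T) (i ∈? T))) (sum-∈≡∣∣ T)
  sum-∈≡∣∣ (inside ∷ T)  = cong suc (trans (sum-cong-≗ (λ i → 𝟙-cong drop-there there (suc i ∈? inside ∷ T) (i ∈? T))) (sum-∈≡∣∣ T))

module AllSubsets where
  open import Data.Nat using (zero; suc)
  open import Data.Bool using (true; false)
  open import Data.Product using (_×_; _,_)
  open import Data.Fin.Subset using (Subset; inside; outside)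
  import Data.Vec as Vec
  open import Data.Vec.Properties using (∷-injectiveʳ)
  open import Data.List using (List; []; _∷_; _++_; map)
  open import Data.List.Membership.Propositional using (_∈_)
  open import Data.List.Membership.Propositional.Properties using (∈-++⁺ˡ; ∈-++⁺ʳ; ∈-map⁺; ∈-map⁻)
  open import Data.List.Relation.Unary.Any using (here)
  open import Data.List.Relation.Unary.All using ([])
  open import Data.List.Relation.Unary.AllPairs using ([]; _∷_)
  open import Data.List.Relation.Unary.Unique.Propositional using (Unique)
  open import Data.List.Relation.Unary.Unique.Propositional.Properties using (++⁺; map⁺)
  open import Relation.Nullary using (¬_)
  open import Relation.Binary.PropositionalEquality using (refl)

  subsets : ∀ n → List (Subset n)
  subsets zero    = Vec.[] ∷ []
  subsets (suc n) = map (outside Vec.∷_) (subsets n) ++ map (inside Vec.∷_) (subsets n)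

  ∈-subsets : ∀ {n} (T : Subset n) → T ∈ subsets n
  ∈-subsets Vec.[]                = here refl
  ∈-subsets {suc n} (false Vec.∷ T) = ∈-++⁺ˡ (∈-map⁺ (outside Vec.∷_) (∈-subsets T))
  ∈-subsets {suc n} (true Vec.∷ T)  = ∈-++⁺ʳ (map (outside Vec.∷_) (subsets n)) (∈-map⁺ (inside Vec.∷_) (∈-subsets T))

  subsets-unique : ∀ n → Unique (subsets n)
  subsets-unique zero    = [] ∷ []
  subsets-unique (suc n) = ++⁺ (map⁺ ∷-injectiveʳ (subsets-unique n)) (map⁺ ∷-injectiveʳ (subsets-unique n)) disjoint
    where
      disjoint : ∀ {T} → ¬ (T ∈ map (outside Vec.∷_) (subsets n) × T ∈ map (inside Vec.∷_) (subsets n))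
      disjoint (T∈out , T∈in) with ∈-map⁻ (outside Vec.∷_) T∈out | ∈-map⁻ (inside Vec.∷_) T∈in
      ... | _ , _ , refl | _ , _ , ()

module Triple {X : Set} where
  open import Data.Product using (_×_)
  open import Data.Sum using (_⊎_; inj₁; inj₂)
  open import Relation.Binary.PropositionalEquality using (_≡_; _≢_)

  Distinct : X → X → X → Set
  Distinct x y z = x ≢ y × x ≢ z × y ≢ z

  OneOf : X → X → X → X → Set
  OneOf x y z w = w ≡ x ⊎ w ≡ y ⊎ w ≡ z

  OneOf-rotate : ∀ {x y z w} → OneOf x y z w → OneOf y z x w
  OneOf-rotate (inj₁ w≡x)        = inj₂ (inj₂ w≡x)
  OneOf-rotate (inj₂ (inj₁ w≡y)) = inj₁ w≡y
  OneOf-rotate (inj₂ (inj₂ w≡z)) = inj₂ (inj₁ w≡z)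

module FiniteSum {X : Set} {n : ℕ} (enum : X ↔ Fin n) where
  open import Data.Nat using (zero; suc; _+_; _*_)
  open import Data.Nat.Properties using (+-*-semiring; *-zeroʳ; *-identityʳ; +-comm)
  open import Algebra.Properties.Semiring.Sum +-*-semiring
    using (sum; sum-cong-≗; ∑-distrib-+; ∑-comm; sum-permute; *-distribˡ-sum; *-distribʳ-sum)
  import Data.Fin.Properties as Fin
  open import Data.Fin.Permutation using (Permutation)
  open import Data.Fin.Subset using (Subset; _∈_; ∣_∣)
  import Data.Fin.Subset as Sub
  open import Data.Fin.Subset.Properties using (_∈?_; x∈⁅x⁆; x∈⁅y⁆⇒x≡y; ∣⁅x⁆∣≡1)
  open import Data.List using (List; []; _∷_; length)
  open import Data.Product using (∃; _×_; _,_)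
  open import Data.Sum using (_⊎_; inj₁; inj₂)
  open import Function.Bundles using (Inverse; mk↔ₛ′; Equivalence)
  open import Relation.Nullary using (¬_; Dec; yes; no; ¬?)
  open import Relation.Nullary.Decidable using (_×-dec_; _⊎-dec_; map′)
  open import Relation.Unary using (Pred; Decidable)
  open import Relation.Binary using (DecidableEquality)
  open import Relation.Binary.PropositionalEquality using (_≡_; _≢_; refl; sym; trans; cong; subst)
  open Indicator
  open ListSum using (∑ˡ; ∑ˡ-cong; ∑ˡ-δ-∈; ∑ˡ-δ-∉; ∑ˡ-const-1)
  open FinSubset using (sum-∈≡∣∣)
  open Inverse enum public using (to; from)

  from-to : ∀ x → from (to x) ≡ x
  from-to = Inverse.strictlyInverseʳ enum

  to-from : ∀ i → to (from i) ≡ i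
  to-from = Inverse.strictlyInverseˡ enum

  to-injective : ∀ {x y} → to x ≡ to y → x ≡ y
  to-injective {x} {y} e = trans (sym (from-to x)) (trans (cong from e) (from-to y))

  infix 4 _≟_
  _≟_ : DecidableEquality X
  x ≟ y = map′ to-injective (cong to) (to x Fin.≟ to y)

  ∃? : ∀ {p} {P : Pred X p} → Decidable P → Dec (∃ P)
  ∃? {P = P} P? = map′ (λ (i , p) → from i , p) (λ (x , p) → to x , subst P (sym (from-to x)) p)
                       (Fin.any? (λ i → P? (from i)))

  ∀? : ∀ {p} {P : Pred X p} → Decidable P → Dec (∀ x → P x)
  ∀? {P = P} P? = map′ (λ f x → subst P (from-to x) (f (to x))) (λ f i → f (from i))
                       (Fin.all? (λ i → P? (from i)))

  infix 4 _∈X_ _∈X?_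
  _∈X_ : X → Subset n → Set
  x ∈X T = to x ∈ T

  _∈X?_ : ∀ x T → Dec (x ∈X T)
  x ∈X? T = to x ∈? T

  -- Abstract, so that unification never unfolds the underlying sum over Fin n.
  abstract
    ∑ : (X → ℕ) → ℕ
    ∑ f = sum (λ i → f (from i))

    ∑-cong : ∀ {f g : X → ℕ} → (∀ x → f x ≡ g x) → ∑ f ≡ ∑ g
    ∑-cong f≗g = sum-cong-≗ (λ i → f≗g (from i))

    ∑-+ : ∀ (f g : X → ℕ) → ∑ (λ x → f x + g x) ≡ ∑ f + ∑ g
    ∑-+ f g = ∑-distrib-+ (λ i → f (from i)) (λ i → g (from i))

    ∑-swap : ∀ (f : X → X → ℕ) → ∑ (λ x → ∑ (λ y → f x y)) ≡ ∑ (λ y → ∑ (λ x → f x y))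
    ∑-swap f = ∑-comm (λ i j → f (from i) (from j))

    ∑-const : ∀ c → ∑ (λ _ → c) ≡ n * c
    ∑-const c = sum-const n
      where
        sum-const : ∀ m → sum {m} (λ _ → c) ≡ m * c
        sum-const zero    = refl
        sum-const (suc m) = cong (c +_) (sum-const m)

    ∑-*ˡ : ∀ c (f : X → ℕ) → ∑ (λ x → c * f x) ≡ c * ∑ f
    ∑-*ˡ c f = sym (*-distribˡ-sum c (λ i → f (from i)))

    ∑-*ʳ : ∀ c (f : X → ℕ) → ∑ (λ x → f x * c) ≡ ∑ f * c
    ∑-*ʳ c f = sym (*-distribʳ-sum c (λ i → f (from i)))

    ∑-permute : ∀ (π : X ↔ X) (f : X → ℕ) → ∑ (λ x → f (Inverse.to π x)) ≡ ∑ f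
    ∑-permute π f = sym (trans (sum-permute (λ i → f (from i)) σ) (sum-cong-≗ {x = λ i → f (from (to (π→ (from i))))} (λ i → cong f (from-to _))))
      where
        open Inverse π renaming (to to π→; from to π←)
        σ : Permutation n n
        σ = mk↔ₛ′ (λ i → to (π→ (from i))) (λ i → to (π← (from i)))
          (λ i → trans (cong (λ x → to (π→ x)) (from-to _)) (trans (cong to (Inverse.strictlyInverseˡ π _)) (to-from i)))
          (λ i → trans (cong (λ x → to (π← x)) (from-to _)) (trans (cong to (Inverse.strictlyInverseʳ π _)) (to-from i)))

    ∑-∈≡∣∣ : ∀ (T : Subset n) → ∑ (λ x → 𝟙 (x ∈X? T)) ≡ ∣ T ∣
    ∑-∈≡∣∣ T = trans (sum-cong-≗ (λ i → 𝟙-cong (subst (_∈ T) (to-from i)) (subst (_∈ T) (sym (to-from i))) (to (from i) ∈? T) (i ∈? T)))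
                     (sum-∈≡∣∣ T)

  ∑-δ : ∀ a → ∑ (λ x → 𝟙 (x ≟ a)) ≡ 1
  ∑-δ a = trans (∑-cong (λ x → 𝟙-cong (λ x≡a → subst (_∈ Sub.⁅ to a ⁆) (cong to (sym x≡a)) (x∈⁅x⁆ (to a)))
                                       (λ x∈ → to-injective (x∈⁅y⁆⇒x≡y (to a) x∈)) (x ≟ a) (x ∈X? Sub.⁅ to a ⁆)))
                (trans (∑-∈≡∣∣ Sub.⁅ to a ⁆) (∣⁅x⁆∣≡1 (to a)))

  ∑ˡ-∑-swap : ∀ {Y : Set} (ys : List Y) (g : Y → X → ℕ) → ∑ˡ ys (λ y → ∑ (g y)) ≡ ∑ (λ x → ∑ˡ ys (λ y → g y x))
  ∑ˡ-∑-swap []       g = sym (trans (∑-const 0) (*-zeroʳ n))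
  ∑ˡ-∑-swap (y ∷ ys) g = trans (cong (∑ (g y) +_) (∑ˡ-∑-swap ys g)) (sym (∑-+ (g y) _))

  module _ {P : X → Set} (P? : Decidable P) where
    ∑-remove : ∀ {a} → P a → ∑ (λ x → 𝟙 (P? x)) ≡ suc (∑ (λ x → 𝟙 (P? x ×-dec ¬? (x ≟ a))))
    ∑-remove {a} pa = trans (∑-cong split) (trans (∑-+ _ _) (trans (cong (rest +_) (∑-δ a)) (+-comm rest 1)))
      where
        rest = ∑ (λ x → 𝟙 (P? x ×-dec ¬? (x ≟ a)))
        split : ∀ x → 𝟙 (P? x) ≡ 𝟙 (P? x ×-dec ¬? (x ≟ a)) + 𝟙 (x ≟ a)
        split x = trans (𝟙-cong to⊎ from⊎ (P? x) ((P? x ×-dec ¬? (x ≟ a)) ⊎-dec (x ≟ a)))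
                        (𝟙-⊎ (λ ((_ , x≢a) , x≡a) → x≢a x≡a) _ (x ≟ a))
          where
            to⊎ : P x → (P x × x ≢ a) ⊎ x ≡ a
            to⊎ px with x ≟ a
            ... | yes x≡a = inj₂ x≡a
            ... | no x≢a  = inj₁ (px , x≢a)
            from⊎ : (P x × x ≢ a) ⊎ x ≡ a → P x
            from⊎ (inj₁ (px , _)) = px
            from⊎ (inj₂ refl)     = pa

    ∑-complement : ∑ (λ x → 𝟙 (P? x)) + ∑ (λ x → 𝟙 (¬? (P? x))) ≡ n
    ∑-complement = trans (sym (∑-+ _ _)) (trans (∑-cong (λ x → 𝟙-¬ (P? x))) (trans (∑-const 1) (*-identityʳ n)))

    HasSize⇒∑ : ∀ {k} → HasSize k P → k ≡ ∑ (λ x → 𝟙 (P? x))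
    HasSize⇒∑ (xs , unique , xs⇔P , refl) = begin
      length xs                                 ≡⟨ sym (∑ˡ-const-1 xs) ⟩
      ∑ˡ xs (λ _ → 1)                           ≡⟨ sym (∑ˡ-cong xs ∑-δ) ⟩
      ∑ˡ xs (λ y → ∑ (λ x → 𝟙 (x ≟ y)))        ≡⟨ ∑ˡ-∑-swap xs (λ y x → 𝟙 (x ≟ y)) ⟩
      ∑ (λ x → ∑ˡ xs (λ y → 𝟙 (x ≟ y)))        ≡⟨ ∑-cong occurrences ⟩
      ∑ (λ x → 𝟙 (P? x))                        ∎
      where
        open Relation.Binary.PropositionalEquality.≡-Reasoning
        occurrences : ∀ x → ∑ˡ xs (λ y → 𝟙 (x ≟ y)) ≡ 𝟙 (P? x)
        occurrences x with P? x
        ... | yes px = ∑ˡ-δ-∈ _≟_ unique (Equivalence.from (xs⇔P x) px)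
        ... | no ¬px = ∑ˡ-δ-∉ _≟_ xs (λ x∈ → ¬px (Equivalence.to (xs⇔P x) x∈))

module ThreeElementSubsets {X : Set} {n : ℕ} (enum : X ↔ Fin n) where
  open import Data.Nat using (_+_; _*_)
  open import Data.Nat.Properties using (*-identityʳ; suc-injective)
  open import Data.Fin.Subset using (Subset; _∈_; _∪_; ∣_∣)
  import Data.Fin.Subset as Sub
  open import Data.Fin.Subset.Properties using (x∈⁅x⁆; x∈⁅y⁆⇒x≡y; x∈p∪q⁻; x∈p∪q⁺; ⊆-antisym)
  open import Data.Product using (_×_; _,_)
  open import Data.Sum using (inj₁; inj₂)
  open import Relation.Nullary using (¬_; Dec; yes; no; ¬?)
  open import Relation.Nullary.Decidable using (_×-dec_; _⊎-dec_)
  open import Relation.Binary.PropositionalEquality using (_≡_; _≢_; refl; sym; trans; cong; cong₂; subst; ≢-sym)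
  open Indicator
  open Triple {X}
  open FiniteSum enum

  Distinct? : ∀ x y z → Dec (Distinct x y z)
  Distinct? x y z = ¬? (x ≟ y) ×-dec ¬? (x ≟ z) ×-dec ¬? (y ≟ z)

  OneOf? : ∀ x y z w → Dec (OneOf x y z w)
  OneOf? x y z w = (w ≟ x) ⊎-dec (w ≟ y) ⊎-dec (w ≟ z)

  ⁅_,_,_⁆ : X → X → X → Subset n
  ⁅ x , y , z ⁆ = Sub.⁅ to x ⁆ ∪ Sub.⁅ to y ⁆ ∪ Sub.⁅ to z ⁆

  ∈⁅,,⁆⁻ : ∀ {x y z} w → w ∈X ⁅ x , y , z ⁆ → OneOf x y z w
  ∈⁅,,⁆⁻ {x} {y} {z} w w∈ with x∈p∪q⁻ Sub.⁅ to x ⁆ (Sub.⁅ to y ⁆ ∪ Sub.⁅ to z ⁆) w∈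
  ... | inj₁ w∈x = inj₁ (to-injective (x∈⁅y⁆⇒x≡y (to x) w∈x))
  ... | inj₂ w∈yz with x∈p∪q⁻ Sub.⁅ to y ⁆ Sub.⁅ to z ⁆ w∈yz
  ...   | inj₁ w∈y = inj₂ (inj₁ (to-injective (x∈⁅y⁆⇒x≡y (to y) w∈y)))
  ...   | inj₂ w∈z = inj₂ (inj₂ (to-injective (x∈⁅y⁆⇒x≡y (to z) w∈z)))

  ∈⁅,,⁆⁺ : ∀ {x y z} w → OneOf x y z w → w ∈X ⁅ x , y , z ⁆
  ∈⁅,,⁆⁺ {x} {y} {z} w (inj₁ refl)        = x∈p∪q⁺ (inj₁ (x∈⁅x⁆ (to x)))
  ∈⁅,,⁆⁺ {x} {y} {z} w (inj₂ (inj₁ refl)) = x∈p∪q⁺ {p = Sub.⁅ to x ⁆} (inj₂ (x∈p∪q⁺ (inj₁ (x∈⁅x⁆ (to y)))))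
  ∈⁅,,⁆⁺ {x} {y} {z} w (inj₂ (inj₂ refl)) = x∈p∪q⁺ {p = Sub.⁅ to x ⁆} (inj₂ (x∈p∪q⁺ {p = Sub.⁅ to y ⁆} (inj₂ (x∈⁅x⁆ (to z)))))

  ≡-by-members : ∀ {S T : Subset n} → (∀ x → x ∈X S → x ∈X T) → (∀ x → x ∈X T → x ∈X S) → S ≡ T
  ≡-by-members {S} {T} S⊆T T⊆S = ⊆-antisym (λ {i} → via S⊆T) (λ {i} → via T⊆S)
    where
      via : ∀ {U V i} → (∀ x → x ∈X U → x ∈X V) → i ∈ U → i ∈ V
      via {U} {V} {i} U⊆V i∈U = subst (_∈ V) (to-from i) (U⊆V (from i) (subst (_∈ U) (sym (to-from i)) i∈U))

  ∣⁅,,⁆∣≡3 : ∀ {x y z} → Distinct x y z → ∣ ⁅ x , y , z ⁆ ∣ ≡ 3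
  ∣⁅,,⁆∣≡3 {x} {y} {z} (x≢y , x≢z , y≢z) = begin
    ∣ ⁅ x , y , z ⁆ ∣                                       ≡⟨ sym (∑-∈≡∣∣ ⁅ x , y , z ⁆) ⟩
    ∑ (λ w → 𝟙 (w ∈X? ⁅ x , y , z ⁆))                      ≡⟨ ∑-cong split ⟩
    ∑ (λ w → 𝟙 (w ≟ x) + (𝟙 (w ≟ y) + 𝟙 (w ≟ z)))          ≡⟨ ∑-+ _ _ ⟩
    ∑ (λ w → 𝟙 (w ≟ x)) + ∑ (λ w → 𝟙 (w ≟ y) + 𝟙 (w ≟ z)) ≡⟨ cong₂ _+_ (∑-δ x) (trans (∑-+ _ _) (cong₂ _+_ (∑-δ y) (∑-δ z))) ⟩
    3                                                       ∎
    where
      open Relation.Binary.PropositionalEquality.≡-Reasoning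
      split : ∀ w → 𝟙 (w ∈X? ⁅ x , y , z ⁆) ≡ 𝟙 (w ≟ x) + (𝟙 (w ≟ y) + 𝟙 (w ≟ z))
      split w = trans (𝟙-cong (∈⁅,,⁆⁻ w) (∈⁅,,⁆⁺ w) (w ∈X? ⁅ x , y , z ⁆) (OneOf? x y z w))
        (trans (𝟙-⊎ (λ { (refl , inj₁ x≡y) → x≢y x≡y ; (refl , inj₂ x≡z) → x≢z x≡z }) (w ≟ x) _)
               (cong (𝟙 (w ≟ x) +_) (𝟙-⊎ (λ { (refl , y≡z) → y≢z y≡z }) (w ≟ y) (w ≟ z))))

  DistinctIn : Subset n → X → X → X → Set
  DistinctIn T x y z = Distinct x y z × x ∈X T × y ∈X T × z ∈X T

  DistinctIn? : ∀ T x y z → Dec (DistinctIn T x y z)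
  DistinctIn? T x y z = Distinct? x y z ×-dec x ∈X? T ×-dec y ∈X? T ×-dec z ∈X? T

  module OfSize3 (T : Subset n) (∣T∣≡3 : ∣ T ∣ ≡ 3) where
    InT? : ∀ w → Dec (w ∈X T)
    InT? w = w ∈X? T

    InT∖₁? : ∀ x w → Dec (w ∈X T × w ≢ x)
    InT∖₁? x w = InT? w ×-dec ¬? (w ≟ x)

    InT∖₂? : ∀ x y w → Dec ((w ∈X T × w ≢ x) × w ≢ y)
    InT∖₂? x y w = InT∖₁? x w ×-dec ¬? (w ≟ y)

    InT∖₃? : ∀ x y z w → Dec (((w ∈X T × w ≢ x) × w ≢ y) × w ≢ z)
    InT∖₃? x y z w = InT∖₂? x y w ×-dec ¬? (w ≟ z)

    count₀ : ∑ (λ w → 𝟙 (InT? w)) ≡ 3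
    count₀ = trans (∑-∈≡∣∣ T) ∣T∣≡3

    count₁ : ∀ {x} → x ∈X T → ∑ (λ w → 𝟙 (InT∖₁? x w)) ≡ 2
    count₁ x∈ = suc-injective (trans (sym (∑-remove InT? x∈)) count₀)

    count₂ : ∀ {x y} → x ∈X T → y ∈X T → y ≢ x → ∑ (λ w → 𝟙 (InT∖₂? x y w)) ≡ 1
    count₂ {x} x∈ y∈ y≢x = suc-injective (trans (sym (∑-remove (InT∖₁? x) (y∈ , y≢x))) (count₁ x∈))

    count₃ : ∀ {x y z} → DistinctIn T x y z → ∑ (λ w → 𝟙 (InT∖₃? x y z w)) ≡ 0
    count₃ {x} {y} ((x≢y , x≢z , y≢z) , x∈ , y∈ , z∈) =
      suc-injective (trans (sym (∑-remove (InT∖₂? x y) ((z∈ , ≢-sym x≢z) , ≢-sym y≢z))) (count₂ x∈ y∈ (≢-sym x≢y)))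

    members : ∀ {x y z} → DistinctIn T x y z → ∀ w → w ∈X T → OneOf x y z w
    members {x} {y} {z} d w w∈ with w ≟ x | w ≟ y | w ≟ z
    ... | yes w≡x | _       | _       = inj₁ w≡x
    ... | no _    | yes w≡y | _       = inj₂ (inj₁ w≡y)
    ... | no _    | no _    | yes w≡z = inj₂ (inj₂ w≡z)
    ... | no w≢x  | no w≢y  | no w≢z  with trans (sym (∑-remove (InT∖₃? x y z) (((w∈ , w≢x) , w≢y) , w≢z))) (count₃ d)
    ...   | ()

    ∑-DistinctIn : ∑ (λ x → ∑ (λ y → ∑ (λ z → 𝟙 (DistinctIn? T x y z)))) ≡ 6
    ∑-DistinctIn = begin
      ∑ (λ x → ∑ (λ y → ∑ (λ z → 𝟙 (DistinctIn? T x y z))))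
        ≡⟨ ∑-cong (λ x → ∑-cong (λ y → ∑-cong (λ z → factor x y z))) ⟩
      ∑ (λ x → ∑ (λ y → ∑ (λ z → 𝟙 (InT? x) * (𝟙 (InT∖₁? x y) * 𝟙 (InT∖₂? x y z)))))
        ≡⟨ ∑-cong (λ x → ∑-cong (λ y → ∑-over-z x y)) ⟩
      ∑ (λ x → ∑ (λ y → 𝟙 (InT? x) * 𝟙 (InT∖₁? x y)))
        ≡⟨ ∑-cong (λ x → trans (∑-*ˡ (𝟙 (InT? x)) _) (𝟙-*-cong (InT? x) count₁)) ⟩
      ∑ (λ x → 𝟙 (InT? x) * 2)
        ≡⟨ trans (∑-*ʳ 2 _) (cong (_* 2) count₀) ⟩
      6 ∎
      where
        open Relation.Binary.PropositionalEquality.≡-Reasoning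
        factor : ∀ x y z → 𝟙 (DistinctIn? T x y z) ≡ 𝟙 (InT? x) * (𝟙 (InT∖₁? x y) * 𝟙 (InT∖₂? x y z))
        factor x y z = trans (𝟙-cong reorder unorder (DistinctIn? T x y z) (InT? x ×-dec InT∖₁? x y ×-dec InT∖₂? x y z))
                             (trans (𝟙-× (InT? x) _) (cong (𝟙 (InT? x) *_) (𝟙-× (InT∖₁? x y) _)))
          where
            reorder : DistinctIn T x y z → x ∈X T × (y ∈X T × y ≢ x) × ((z ∈X T × z ≢ x) × z ≢ y)
            reorder ((x≢y , x≢z , y≢z) , x∈ , y∈ , z∈) = x∈ , (y∈ , ≢-sym x≢y) , ((z∈ , ≢-sym x≢z) , ≢-sym y≢z)
            unorder : x ∈X T × (y ∈X T × y ≢ x) × ((z ∈X T × z ≢ x) × z ≢ y) → DistinctIn T x y z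
            unorder (x∈ , (y∈ , y≢x) , ((z∈ , z≢x) , z≢y)) = (≢-sym y≢x , ≢-sym z≢x , ≢-sym z≢y) , x∈ , y∈ , z∈
        ∑-over-z : ∀ x y → ∑ (λ z → 𝟙 (InT? x) * (𝟙 (InT∖₁? x y) * 𝟙 (InT∖₂? x y z))) ≡ 𝟙 (InT? x) * 𝟙 (InT∖₁? x y)
        ∑-over-z x y = begin
          ∑ (λ z → 𝟙 (InT? x) * (𝟙 (InT∖₁? x y) * 𝟙 (InT∖₂? x y z)))
            ≡⟨ trans (∑-*ˡ (𝟙 (InT? x)) _) (cong (𝟙 (InT? x) *_) (∑-*ˡ (𝟙 (InT∖₁? x y)) _)) ⟩
          𝟙 (InT? x) * (𝟙 (InT∖₁? x y) * ∑ (λ z → 𝟙 (InT∖₂? x y z)))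
            ≡⟨ 𝟙-*-cong (InT? x) (λ x∈ → 𝟙-*-cong (InT∖₁? x y) (λ (y∈ , y≢x) → count₂ x∈ y∈ y≢x)) ⟩
          𝟙 (InT? x) * (𝟙 (InT∖₁? x y) * 1)
            ≡⟨ cong (𝟙 (InT? x) *_) (*-identityʳ _) ⟩
          𝟙 (InT? x) * 𝟙 (InT∖₁? x y) ∎

module Arithmetic where
  open import Data.Nat using (ℕ; suc; _+_; _*_; _∸_; _%_; _≤_; _<_; s≤s; z≤n)
  open import Data.Nat.Properties using (<-cmp; _<?_; <-asym; <-trans; m∸n+n≡m; +-comm)
  open import Data.Nat.DivMod using (m∣n⇒o%n%m≡o%m)
  open import Data.Nat.Divisibility using (_∣_; divides; n∣m⇒m%n≡0)
  open import Data.Integer as ℤ using (ℤ; +_)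
  open import Data.Integer.Properties using (pos-*; *-comm)
  open import Data.Integer.Tactic.RingSolver using (solve-∀)
  open import Data.Product using (_×_; _,_)
  open import Data.Sum using (_⊎_; inj₁; inj₂)
  open import Data.Empty using (⊥-elim)
  open import Relation.Nullary using (¬_; Dec)
  open import Relation.Nullary.Decidable using (_×-dec_)
  open import Relation.Binary using (tri<; tri≈; tri>)
  open import Relation.Binary.PropositionalEquality
  open Indicator

  mod6⇒¬3∣ : ∀ {n} → n % 6 ≡ 2 ⊎ n % 6 ≡ 4 → ¬ 3 ∣ n
  mod6⇒¬3∣ {n} n%6 3∣n = residue n%6 (trans (m∣n⇒o%n%m≡o%m 3 6 n (divides 2 refl)) (n∣m⇒m%n≡0 n 3 3∣n))
    where
      residue : n % 6 ≡ 2 ⊎ n % 6 ≡ 4 → n % 6 % 3 ≢ 0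
      residue (inj₁ n%6≡2) rewrite n%6≡2 = λ ()
      residue (inj₂ n%6≡4) rewrite n%6≡4 = λ ()

  mod6⇒2≤ : ∀ {n} → n % 6 ≡ 2 ⊎ n % 6 ≡ 4 → 2 ≤ n
  mod6⇒2≤ {0}           (inj₁ ())
  mod6⇒2≤ {0}           (inj₂ ())
  mod6⇒2≤ {1}           (inj₁ ())
  mod6⇒2≤ {1}           (inj₂ ())
  mod6⇒2≤ {suc (suc n)} _ = s≤s (s≤s z≤n)

  Least : ℕ → ℕ → ℕ → Set
  Least i j k = i < j × i < k

  Least? : ∀ i j k → Dec (Least i j k)
  Least? i j k = i <? j ×-dec i <? k

  exactly-one-least : ∀ {i j k} → i ≢ j → i ≢ k → j ≢ k → 𝟙 (Least? i j k) + 𝟙 (Least? j k i) + 𝟙 (Least? k i j) ≡ 1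
  exactly-one-least {i} {j} {k} i≢j i≢k j≢k = go (compare i≢j) (compare j≢k) (compare i≢k)
    where
      compare : ∀ {a b} → a ≢ b → a < b ⊎ b < a
      compare {a} {b} a≢b with <-cmp a b
      ... | tri< a<b _ _ = inj₁ a<b
      ... | tri≈ _ a≡b _ = ⊥-elim (a≢b a≡b)
      ... | tri> _ _ b<a = inj₂ b<a

      sum : ∀ {a b c} → 𝟙 (Least? i j k) ≡ a → 𝟙 (Least? j k i) ≡ b → 𝟙 (Least? k i j) ≡ c → a + b + c ≡ 1 →
            𝟙 (Least? i j k) + 𝟙 (Least? j k i) + 𝟙 (Least? k i j) ≡ 1
      sum eᵢ eⱼ eₖ abc = trans (cong₂ _+_ (cong₂ _+_ eᵢ eⱼ) eₖ) abc

      go : i < j ⊎ j < i → j < k ⊎ k < j → i < k ⊎ k < i → 𝟙 (Least? i j k) + 𝟙 (Least? j k i) + 𝟙 (Least? k i j) ≡ 1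
      go (inj₁ i<j) (inj₁ j<k) (inj₁ i<k) = sum (𝟙-yes (i<j , i<k) _) (𝟙-no (λ (_ , j<i) → <-asym i<j j<i) _) (𝟙-no (λ (k<i , _) → <-asym i<k k<i) _) refl
      go (inj₁ i<j) (inj₁ j<k) (inj₂ k<i) = ⊥-elim (<-asym (<-trans i<j j<k) k<i)
      go (inj₁ i<j) (inj₂ k<j) (inj₁ i<k) = sum (𝟙-yes (i<j , i<k) _) (𝟙-no (λ (j<k , _) → <-asym k<j j<k) _) (𝟙-no (λ (k<i , _) → <-asym i<k k<i) _) refl
      go (inj₁ i<j) (inj₂ k<j) (inj₂ k<i) = sum (𝟙-no (λ (_ , i<k) → <-asym k<i i<k) _) (𝟙-no (λ (j<k , _) → <-asym k<j j<k) _) (𝟙-yes (k<i , k<j) _) refl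
      go (inj₂ j<i) (inj₁ j<k) (inj₁ i<k) = sum (𝟙-no (λ (i<j , _) → <-asym j<i i<j) _) (𝟙-yes (j<k , j<i) _) (𝟙-no (λ (k<i , _) → <-asym i<k k<i) _) refl
      go (inj₂ j<i) (inj₁ j<k) (inj₂ k<i) = sum (𝟙-no (λ (i<j , _) → <-asym j<i i<j) _) (𝟙-yes (j<k , j<i) _) (𝟙-no (λ (_ , k<j) → <-asym j<k k<j) _) refl
      go (inj₂ j<i) (inj₂ k<j) (inj₁ i<k) = ⊥-elim (<-asym (<-trans k<j j<i) i<k)
      go (inj₂ j<i) (inj₂ k<j) (inj₂ k<i) = sum (𝟙-no (λ (i<j , _) → <-asym j<i i<j) _) (𝟙-no (λ (j<k , _) → <-asym k<j j<k) _) (𝟙-yes (k<i , k<j) _) refl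

  private
    ring-identity : ∀ (v o ω₂ : ℤ) →
      v ℤ.* (o ℤ.* (v ℤ.- + 2) ℤ.+ ((v ℤ.- (+ 1 ℤ.+ o)) ℤ.* o ℤ.+ ((v ℤ.- (+ 1 ℤ.+ o)) ℤ.* o ℤ.+ ((v ℤ.- ω₂) ℤ.+ ((v ℤ.- ω₂) ℤ.+ (v ℤ.- ω₂))))))
      ≡ + 3 ℤ.* v ℤ.* v ℤ.* (+ 1 ℤ.+ o) ℤ.- v ℤ.* ((+ 2 ℤ.* (+ 1 ℤ.+ o) ℤ.* (+ 1 ℤ.+ o) ℤ.+ + 3 ℤ.* ω₂) ℤ.- + 2)
    ring-identity = solve-∀

    substitute : ∀ {v o ω₂ d n₁ n₂ : ℤ} → d ≡ v ℤ.- + 2 → n₁ ≡ v ℤ.- (+ 1 ℤ.+ o) → n₂ ≡ v ℤ.- ω₂ →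
      v ℤ.* (o ℤ.* d ℤ.+ (n₁ ℤ.* o ℤ.+ (n₁ ℤ.* o ℤ.+ (n₂ ℤ.+ (n₂ ℤ.+ n₂)))))
      ≡ + 3 ℤ.* v ℤ.* v ℤ.* (+ 1 ℤ.+ o) ℤ.- v ℤ.* ((+ 2 ℤ.* (+ 1 ℤ.+ o) ℤ.* (+ 1 ℤ.+ o) ℤ.+ + 3 ℤ.* ω₂) ℤ.- + 2)
    substitute {v} {o} {ω₂} refl refl refl = ring-identity v o ω₂

    +-as-difference : ∀ {a b c} → a + b ≡ c → + b ≡ + c ℤ.- + a
    +-as-difference {a} {b} refl = identity (+ a) (+ b)
      where
        identity : ∀ (a b : ℤ) → b ≡ (a ℤ.+ b) ℤ.- a
        identity = solve-∀

  closed-form : ∀ {N v ω₁ ω₂ o₁ n₁ n₂} → 2 ≤ v → suc o₁ ≡ ω₁ → ω₁ + n₁ ≡ v → ω₂ + n₂ ≡ v →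
    N * 6 ≡ v * (o₁ * (v ∸ 2) + (n₁ * o₁ + (n₁ * o₁ + (n₂ + (n₂ + n₂))))) →
    + 6 ℤ.* + N ≡ + 3 ℤ.* + v ℤ.* + v ℤ.* + ω₁ ℤ.- + v ℤ.* (+ (2 * ω₁ * ω₁ + 3 * ω₂) ℤ.- + 2)
  closed-form {N} {v} {ω₁} {ω₂} {o₁} {n₁} {n₂} 2≤v refl ω₁+n₁≡v ω₂+n₂≡v N*6≡v*M = begin
    + 6 ℤ.* + N
      ≡⟨ trans (*-comm (+ 6) (+ N)) (sym (pos-* N 6)) ⟩
    + (N * 6)
      ≡⟨ trans (cong +_ N*6≡v*M) (pos-* v _) ⟩
    + v ℤ.* + (o₁ * (v ∸ 2) + (n₁ * o₁ + (n₁ * o₁ + (n₂ + (n₂ + n₂)))))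
      ≡⟨ cong (+ v ℤ.*_) (cong₂ ℤ._+_ (pos-* o₁ (v ∸ 2)) (cong₂ ℤ._+_ (pos-* n₁ o₁) (cong₂ ℤ._+_ (pos-* n₁ o₁) refl))) ⟩
    + v ℤ.* (+ o₁ ℤ.* + (v ∸ 2) ℤ.+ (+ n₁ ℤ.* + o₁ ℤ.+ (+ n₁ ℤ.* + o₁ ℤ.+ (+ n₂ ℤ.+ (+ n₂ ℤ.+ + n₂)))))
      ≡⟨ substitute {+ v} {+ o₁} {+ ω₂} (+-as-difference {2} (trans (+-comm 2 (v ∸ 2)) (m∸n+n≡m 2≤v)))
                                      (+-as-difference {suc o₁} ω₁+n₁≡v) (+-as-difference {ω₂} ω₂+n₂≡v) ⟩
    + 3 ℤ.* + v ℤ.* + v ℤ.* + ω₁ ℤ.- + v ℤ.* ((+ 2 ℤ.* + ω₁ ℤ.* + ω₁ ℤ.+ + 3 ℤ.* + ω₂) ℤ.- + 2)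
      ≡⟨ cong (λ q → + 3 ℤ.* + v ℤ.* + v ℤ.* + ω₁ ℤ.- + v ℤ.* (q ℤ.- + 2)) (sym quadratic-cast) ⟩
    + 3 ℤ.* + v ℤ.* + v ℤ.* + ω₁ ℤ.- + v ℤ.* (+ (2 * ω₁ * ω₁ + 3 * ω₂) ℤ.- + 2) ∎
    where
      open ≡-Reasoning
      quadratic-cast : + (2 * ω₁ * ω₁ + 3 * ω₂) ≡ + 2 ℤ.* + ω₁ ℤ.* + ω₁ ℤ.+ + 3 ℤ.* + ω₂
      quadratic-cast = cong₂ ℤ._+_ (trans (pos-* (2 * ω₁) ω₁) (cong (ℤ._* + ω₁) (pos-* 2 ω₁))) (pos-* 3 ω₂)

module GroupFacts (A : FinAbGroup) where
  open import Level using (0ℓ)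
  open import Algebra.Bundles using (AbelianGroup)
  open import Algebra.Structures using (IsAbelianGroup)
  open import Function.Base using (_∘_)
  open import Relation.Nullary using (Dec)
  open import Relation.Binary.PropositionalEquality
  open FinAbGroup A
  open IsAbelianGroup isAbelianGroup using (assoc; identityˡ; identityʳ; inverseˡ; inverseʳ)
  open FiniteSum enum using (_≟_)

  private
    abelianGroup : AbelianGroup 0ℓ 0ℓ
    abelianGroup = record { Carrier = Carrier ; _≈_ = _≡_ ; _∙_ = _+_ ; ε = 0# ; _⁻¹ = -_ ; isAbelianGroup = isAbelianGroup }
  open import Algebra.Properties.AbelianGroup abelianGroup public
    using (identityˡ-unique; identityʳ-unique)
    renaming (x∙y⁻¹≈ε⇒x≈y to x-y≡0⇒x≡y; inverseʳ-unique to x+y≡0⇒y≡-x; ε⁻¹≈ε to -0≡0;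
              ⁻¹-injective to -‿injective; ⁻¹-involutive to -‿involutive; ⁻¹-anti-homo‿- to -[x-y]≡y-x)
  open import Algebra.Properties.AbelianGroup abelianGroup using (∙-cancelˡ; ∙-cancelʳ; ⁻¹-∙-comm)
  open import Algebra.Solver.CommutativeMonoid (AbelianGroup.commutativeMonoid abelianGroup) using (solve; _⊕_; _⊜_)

  infixl 6 _-_
  _-_ : Carrier → Carrier → Carrier
  x - y = x + - y

  cancelˡ : ∀ t {a b} → t + a ≡ t + b → a ≡ b
  cancelˡ t {a} {b} = ∙-cancelˡ t a b

  cancelʳ : ∀ {a b} t → a + t ≡ b + t → a ≡ b
  cancelʳ {a} {b} t = ∙-cancelʳ t a b

  -x≡0⇒x≡0 : ∀ {a} → - a ≡ 0# → a ≡ 0#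
  -x≡0⇒x≡0 {a} -a≡0 = trans (sym (-‿involutive a)) (trans (cong -_ -a≡0) -0≡0)

  -‿+ : ∀ a b → - (a + b) ≡ - a + - b
  -‿+ a b = sym (⁻¹-∙-comm a b)

  x-0≡x : ∀ x → x - 0# ≡ x
  x-0≡x x = trans (cong (x +_) -0≡0) (identityʳ x)

  0-x≡-x : ∀ x → 0# - x ≡ - x
  0-x≡-x x = identityˡ (- x)

  x-y+y≡x : ∀ x y → (x - y) + y ≡ x
  x-y+y≡x x y = trans (assoc x (- y) y) (trans (cong (x +_) (inverseˡ y)) (identityʳ x))

  x+y-y≡x : ∀ x y → (x + y) - y ≡ x
  x+y-y≡x x y = trans (assoc x y (- y)) (trans (cong (x +_) (inverseʳ y)) (identityʳ x))

  x+t-[y+t]≡x-y : ∀ x y t → (x + t) - (y + t) ≡ x - y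
  x+t-[y+t]≡x-y x y t = begin
    (x + t) + - (y + t)   ≡⟨ cong ((x + t) +_) (-‿+ y t) ⟩
    (x + t) + (- y + - t) ≡⟨ solve 4 (λ a b c d → (a ⊕ b) ⊕ (c ⊕ d) ⊜ (a ⊕ c) ⊕ (b ⊕ d)) refl x t (- y) (- t) ⟩
    (x - y) + (t - t)     ≡⟨ cong ((x - y) +_) (inverseʳ t) ⟩
    (x - y) + 0#          ≡⟨ identityʳ _ ⟩
    x - y                 ∎
    where open ≡-Reasoning

  +-interchange : ∀ a b t → (a + t) + (b + t) ≡ (a + b) + (t + t)
  +-interchange = solve 3 (λ a b t → (a ⊕ t) ⊕ (b ⊕ t) ⊜ (a ⊕ b) ⊕ (t ⊕ t)) refl

  double-sum : ∀ p q → (p + q) + (p + q) ≡ (p + p) + (q + q)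
  double-sum = solve 2 (λ p q → (p ⊕ q) ⊕ (p ⊕ q) ⊜ (p ⊕ p) ⊕ (q ⊕ q)) refl

  [x-y]+x≡[x+x]-y : ∀ x y → (x - y) + x ≡ (x + x) - y
  [x-y]+x≡[x+x]-y x y = solve 2 (λ x y′ → (x ⊕ y′) ⊕ x ⊜ (x ⊕ x) ⊕ y′) refl x (- y)

  double≡self⇒0 : ∀ {a} → a + a ≡ a → a ≡ 0#
  double≡self⇒0 {a} 2a≡a = cancelʳ a (trans 2a≡a (sym (identityˡ a)))

  Ω₁ Ω₂ : Carrier → Set
  Ω₁ a = a + a ≡ 0#
  Ω₂ a = (a + a) + (a + a) ≡ 0#

  Ω₁? : ∀ a → Dec (Ω₁ a)
  Ω₁? a = a + a ≟ 0#

  Ω₂? : ∀ a → Dec (Ω₂ a)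
  Ω₂? a = (a + a) + (a + a) ≟ 0#

  Ω₁-0 : Ω₁ 0#
  Ω₁-0 = identityʳ 0#

  Ω₁-neg : ∀ {a} → Ω₁ a → Ω₁ (- a)
  Ω₁-neg {a} 2a≡0 = trans (sym (-‿+ a a)) (trans (cong -_ 2a≡0) -0≡0)

  Ω₁-neg⁻ : ∀ {a} → Ω₁ (- a) → Ω₁ a
  Ω₁-neg⁻ {a} = subst Ω₁ (-‿involutive a) ∘ Ω₁-neg

  Ω₁-sym : ∀ {x y} → Ω₁ (x - y) → Ω₁ (y - x)
  Ω₁-sym {x} {y} Ω₁x-y = subst Ω₁ (-[x-y]≡y-x x y) (Ω₁-neg Ω₁x-y)

  Ω₁⇒Ω₂ : ∀ {a} → Ω₁ a → Ω₂ a
  Ω₁⇒Ω₂ 2a≡0 = trans (cong₂ _+_ 2a≡0 2a≡0) (identityʳ 0#)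

  Ω₁-+ : ∀ {a b} → Ω₁ a → Ω₁ b → Ω₁ (a + b)
  Ω₁-+ {a} {b} 2a≡0 2b≡0 = trans (double-sum a b) (trans (cong₂ _+_ 2a≡0 2b≡0) (identityʳ 0#))

  Ω₁-cancel : ∀ {a b} → Ω₁ a → Ω₁ (a - b) → Ω₁ b
  Ω₁-cancel {a} {b} Ω₁a Ω₁a-b = subst Ω₁ (x-y+y≡x b a) (Ω₁-+ (Ω₁-sym Ω₁a-b) Ω₁a)

module Shapes (A : FinAbGroup) where
  open import Data.Product using (_×_; _,_)
  open import Data.Sum using (_⊎_; inj₁; inj₂) renaming (map to ⊎-map)
  open import Data.Empty using (⊥-elim)
  open import Function.Base using (_∘_)
  open import Relation.Nullary using (¬_; Dec; yes; no; ¬?)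
  open import Relation.Nullary.Decidable using (_×-dec_; _⊎-dec_)
  open import Relation.Binary.PropositionalEquality
  open import Algebra.Structures using (IsAbelianGroup)
  open FinAbGroup A
  open IsAbelianGroup isAbelianGroup using (assoc; comm; identityˡ; identityʳ; inverseˡ; inverseʳ)
  open Triple {Carrier}
  open FiniteSum enum using (_≟_)
  open ThreeElementSubsets enum using (Distinct?)
  open GroupFacts A

  Midpoint : Carrier → Carrier → Carrier → Set
  Midpoint c p q = p + q ≡ c + c

  -- For distinct x, y, z: the first three cases say {x, y, z} is a translate of some [a, −a],
  -- the last three that it is a translate of some [a, h].
  Shape : Carrier → Carrier → Carrier → Set
  Shape x y z = Midpoint x y z ⊎ Midpoint y z x ⊎ Midpoint z x y ⊎ Ω₁ (x - y) ⊎ Ω₁ (y - z) ⊎ Ω₁ (z - x)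

  Shape? : ∀ x y z → Dec (Shape x y z)
  Shape? x y z = (y + z ≟ x + x) ⊎-dec (z + x ≟ y + y) ⊎-dec (x + y ≟ z + z)
         ⊎-dec Ω₁? (x - y) ⊎-dec Ω₁? (y - z) ⊎-dec Ω₁? (z - x)

  GoodTriple : Carrier → Carrier → Carrier → Set
  GoodTriple x y z = Distinct x y z × Shape x y z

  GoodTriple? : ∀ x y z → Dec (GoodTriple x y z)
  GoodTriple? x y z = Distinct? x y z ×-dec Shape? x y z

  Midpoint-sym : ∀ {c p q} → Midpoint c p q → Midpoint c q p
  Midpoint-sym {c} {p} {q} m = trans (comm q p) m

  Shape-rotate : ∀ {x y z} → Shape x y z → Shape y z x
  Shape-rotate (inj₁ m)                                = inj₂ (inj₂ (inj₁ m))
  Shape-rotate (inj₂ (inj₁ m))                         = inj₁ m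
  Shape-rotate (inj₂ (inj₂ (inj₁ m)))                  = inj₂ (inj₁ m)
  Shape-rotate (inj₂ (inj₂ (inj₂ (inj₁ i))))           = inj₂ (inj₂ (inj₂ (inj₂ (inj₂ i))))
  Shape-rotate (inj₂ (inj₂ (inj₂ (inj₂ (inj₁ i)))))    = inj₂ (inj₂ (inj₂ (inj₁ i)))
  Shape-rotate (inj₂ (inj₂ (inj₂ (inj₂ (inj₂ i)))))    = inj₂ (inj₂ (inj₂ (inj₂ (inj₁ i))))

  Shape-swap : ∀ {x y z} → Shape x y z → Shape y x z
  Shape-swap (inj₁ m)                                = inj₂ (inj₁ (Midpoint-sym m))
  Shape-swap (inj₂ (inj₁ m))                         = inj₁ (Midpoint-sym m)
  Shape-swap (inj₂ (inj₂ (inj₁ m)))                  = inj₂ (inj₂ (inj₁ (Midpoint-sym m)))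
  Shape-swap (inj₂ (inj₂ (inj₂ (inj₁ i))))           = inj₂ (inj₂ (inj₂ (inj₁ (Ω₁-sym i))))
  Shape-swap (inj₂ (inj₂ (inj₂ (inj₂ (inj₁ i)))))    = inj₂ (inj₂ (inj₂ (inj₂ (inj₂ (Ω₁-sym i)))))
  Shape-swap (inj₂ (inj₂ (inj₂ (inj₂ (inj₂ i)))))    = inj₂ (inj₂ (inj₂ (inj₂ (inj₁ (Ω₁-sym i)))))

  Shape-swap₂₃ : ∀ {x y z} → Shape x z y → Shape x y z
  Shape-swap₂₃ = Shape-rotate ∘ Shape-rotate ∘ Shape-swap ∘ Shape-rotate

  private
    Shape-from-first : ∀ {x y z p q} → x ≢ p → x ≢ q → p ≢ q → OneOf x y z p → OneOf x y z q → Shape x p q → Shape x y z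
    Shape-from-first x≢p _   _   (inj₁ refl)        _                  = ⊥-elim (x≢p refl)
    Shape-from-first _   x≢q _   _                  (inj₁ refl)        = ⊥-elim (x≢q refl)
    Shape-from-first _   _   p≢q (inj₂ (inj₁ refl)) (inj₂ (inj₁ refl)) = ⊥-elim (p≢q refl)
    Shape-from-first _   _   _   (inj₂ (inj₁ refl)) (inj₂ (inj₂ refl)) = λ shape → shape
    Shape-from-first _   _   _   (inj₂ (inj₂ refl)) (inj₂ (inj₁ refl)) = Shape-swap₂₃
    Shape-from-first _   _   p≢q (inj₂ (inj₂ refl)) (inj₂ (inj₂ refl)) = ⊥-elim (p≢q refl)

  Shape-of-members : ∀ {x y z u p q} → Distinct u p q → OneOf x y z u → OneOf x y z p → OneOf x y z q → Shape u p q → Shape x y z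
  Shape-of-members (u≢p , u≢q , p≢q) (inj₁ refl)        ∈p ∈q =
    Shape-from-first u≢p u≢q p≢q ∈p ∈q
  Shape-of-members (u≢p , u≢q , p≢q) (inj₂ (inj₁ refl)) ∈p ∈q =
    Shape-rotate ∘ Shape-rotate ∘ Shape-from-first u≢p u≢q p≢q (OneOf-rotate ∈p) (OneOf-rotate ∈q)
  Shape-of-members (u≢p , u≢q , p≢q) (inj₂ (inj₂ refl)) ∈p ∈q =
    Shape-rotate ∘ Shape-from-first u≢p u≢q p≢q (OneOf-rotate (OneOf-rotate ∈p)) (OneOf-rotate (OneOf-rotate ∈q))

  midpoint-+ : ∀ {c p q} t → Midpoint c p q → Midpoint (c + t) (p + t) (q + t)
  midpoint-+ {c} {p} {q} t m = trans (+-interchange p q t) (trans (cong (_+ (t + t)) m) (sym (+-interchange c c t)))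

  midpoint-+⁻ : ∀ {c p q} t → Midpoint (c + t) (p + t) (q + t) → Midpoint c p q
  midpoint-+⁻ {c} {p} {q} t m = cancelʳ (t + t) (trans (sym (+-interchange p q t)) (trans m (+-interchange c c t)))

  Ω₁-diff-+ : ∀ {x y} t → Ω₁ (x - y) → Ω₁ ((x + t) - (y + t))
  Ω₁-diff-+ {x} {y} t = subst Ω₁ (sym (x+t-[y+t]≡x-y x y t))

  Ω₁-diff-+⁻ : ∀ {x y} t → Ω₁ ((x + t) - (y + t)) → Ω₁ (x - y)
  Ω₁-diff-+⁻ {x} {y} t = subst Ω₁ (x+t-[y+t]≡x-y x y t)

  GoodTriple-+ : ∀ {x y z} t → GoodTriple x y z → GoodTriple (x + t) (y + t) (z + t)
  GoodTriple-+ t ((x≢y , x≢z , y≢z) , shape) =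
    (x≢y ∘ cancelʳ t , x≢z ∘ cancelʳ t , y≢z ∘ cancelʳ t) ,
    ⊎-map (midpoint-+ t) (⊎-map (midpoint-+ t) (⊎-map (midpoint-+ t) (⊎-map (Ω₁-diff-+ t) (⊎-map (Ω₁-diff-+ t) (Ω₁-diff-+ t))))) shape

  GoodTriple-+⁻ : ∀ {x y z} t → GoodTriple (x + t) (y + t) (z + t) → GoodTriple x y z
  GoodTriple-+⁻ t ((x≢y , x≢z , y≢z) , shape) =
    (x≢y ∘ cong (_+ t) , x≢z ∘ cong (_+ t) , y≢z ∘ cong (_+ t)) ,
    ⊎-map (midpoint-+⁻ t) (⊎-map (midpoint-+⁻ t) (⊎-map (midpoint-+⁻ t) (⊎-map (Ω₁-diff-+⁻ t) (⊎-map (Ω₁-diff-+⁻ t) (Ω₁-diff-+⁻ t))))) shape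

  midpoint-reflect : ∀ {c p q} → Midpoint c p q → - (p - c) + c ≡ q
  midpoint-reflect {c} {p} {q} m = begin
    - (p - c) + c  ≡⟨ cong (_+ c) (-[x-y]≡y-x p c) ⟩
    (c - p) + c    ≡⟨ [x-y]+x≡[x+x]-y c p ⟩
    (c + c) - p    ≡⟨ cong (_- p) (sym m) ⟩
    (p + q) - p    ≡⟨ cong (_- p) (comm p q) ⟩
    (q + p) - p    ≡⟨ x+y-y≡x q p ⟩
    q              ∎
    where open ≡-Reasoning

  midpoint-Ω₁ : ∀ {c p q} → Midpoint c p q → Ω₁ (p - c) → p ≡ q
  midpoint-Ω₁ {c} {p} {q} m Ω₁p-c = cancelˡ p (trans 2p≡2c (sym m))
    where
      2p≡2c : p + p ≡ c + c
      2p≡2c = x-y≡0⇒x≡y (p + p) (c + c) (trans (cong ((p + p) +_) (-‿+ c c)) (trans (sym (double-sum p (- c))) Ω₁p-c))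

  GoodTriple-orbit₁ : ∀ {a} c → ¬ Ω₁ a → GoodTriple (0# + c) (a + c) (- a + c)
  GoodTriple-orbit₁ {a} c ¬Ω₁a = GoodTriple-+ c ((0≢a , 0≢-a , a≢-a) , inj₁ (trans (inverseʳ a) (sym (identityʳ 0#))))
    where
      0≢a : 0# ≢ a
      0≢a 0≡a = ¬Ω₁a (subst Ω₁ 0≡a Ω₁-0)
      0≢-a : 0# ≢ - a
      0≢-a 0≡-a = 0≢a (sym (-x≡0⇒x≡0 (sym 0≡-a)))
      a≢-a : a ≢ - a
      a≢-a a≡-a = ¬Ω₁a (trans (cong (a +_) a≡-a) (inverseʳ a))

  GoodTriple-orbit₂ : ∀ {a h} c → a ≢ 0# → h ≢ 0# → h ≢ a → Ω₁ h → GoodTriple (0# + c) (a + c) (h + c)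
  GoodTriple-orbit₂ {a} {h} c a≢0 h≢0 h≢a Ω₁h =
    GoodTriple-+ c ((a≢0 ∘ sym , h≢0 ∘ sym , h≢a ∘ sym) , inj₂ (inj₂ (inj₂ (inj₂ (inj₂ (subst Ω₁ (sym (x-0≡x h)) Ω₁h))))))

  -- When A has no element of order 3, a good triple (0, y, z) lies in exactly one of these classes.
  module AtZero (y z : Carrier) where
    Class₁ Class₂ Class₃ Class₄ Class₅ Class₆ : Set
    Class₁ = (Ω₁ y × y ≢ 0#) × (z ≢ y × z ≢ 0#)
    Class₂ = ¬ Ω₁ y × Ω₁ z × z ≢ 0#
    Class₃ = ¬ Ω₁ y × Ω₁ (z - y) × z ≢ y
    Class₄ = ¬ Ω₂ y × z ≡ - y
    Class₅ = ¬ Ω₂ y × z ≡ y + y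
    Class₆ = ¬ Ω₂ z × y ≡ z + z

    Class₁? : Dec Class₁
    Class₁? = (Ω₁? y ×-dec ¬? (y ≟ 0#)) ×-dec (¬? (z ≟ y) ×-dec ¬? (z ≟ 0#))
    Class₂? : Dec Class₂
    Class₂? = ¬? (Ω₁? y) ×-dec Ω₁? z ×-dec ¬? (z ≟ 0#)
    Class₃? : Dec Class₃
    Class₃? = ¬? (Ω₁? y) ×-dec Ω₁? (z - y) ×-dec ¬? (z ≟ y)
    Class₄? : Dec Class₄
    Class₄? = ¬? (Ω₂? y) ×-dec z ≟ - y
    Class₅? : Dec Class₅
    Class₅? = ¬? (Ω₂? y) ×-dec z ≟ y + y
    Class₆? : Dec Class₆
    Class₆? = ¬? (Ω₂? z) ×-dec y ≟ z + z

    Classes : Set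
    Classes = Class₁ ⊎ Class₂ ⊎ Class₃ ⊎ Class₄ ⊎ Class₅ ⊎ Class₆

    z-y≡-[y+y] : z ≡ - y → z - y ≡ - (y + y)
    z-y≡-[y+y] z≡-y = trans (cong (_- y) z≡-y) (sym (-‿+ y y))

    classify : GoodTriple 0# y z → Classes
    classify ((0≢y , 0≢z , y≢z) , shape) with Ω₁? y | Ω₁? z | Ω₁? (z - y)
    ... | yes Ω₁y | _       | _         = inj₁ ((Ω₁y , ≢-sym 0≢y) , (≢-sym y≢z , ≢-sym 0≢z))
    ... | no ¬Ω₁y | yes Ω₁z | _         = inj₂ (inj₁ (¬Ω₁y , Ω₁z , ≢-sym 0≢z))
    ... | no ¬Ω₁y | no _    | yes Ω₁z-y = inj₂ (inj₂ (inj₁ (¬Ω₁y , Ω₁z-y , ≢-sym y≢z)))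
    ... | no ¬Ω₁y | no ¬Ω₁z | no ¬Ω₁z-y = inj₂ (inj₂ (inj₂ (midpointClass shape)))
      where
        midpointClass : Shape 0# y z → Class₄ ⊎ Class₅ ⊎ Class₆
        midpointClass (inj₁ m) = inj₁ ((λ Ω₂y → ¬Ω₁z-y (subst Ω₁ (sym (z-y≡-[y+y] z≡-y)) (Ω₁-neg Ω₂y))) , z≡-y)
          where z≡-y = x+y≡0⇒y≡-x y z (trans m (identityʳ 0#))
        midpointClass (inj₂ (inj₁ m)) = inj₂ (inj₁ ((λ Ω₂y → ¬Ω₁z (subst Ω₁ (sym z≡2y) Ω₂y)) , z≡2y))
          where z≡2y = trans (sym (identityʳ z)) m
        midpointClass (inj₂ (inj₂ (inj₁ m))) = inj₂ (inj₂ ((λ Ω₂z → ¬Ω₁y (subst Ω₁ (sym y≡2z) Ω₂z)) , y≡2z))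
          where y≡2z = trans (sym (identityˡ y)) m
        midpointClass (inj₂ (inj₂ (inj₂ (inj₁ i))))         = ⊥-elim (¬Ω₁y (Ω₁-neg⁻ (subst Ω₁ (0-x≡-x y) i)))
        midpointClass (inj₂ (inj₂ (inj₂ (inj₂ (inj₁ i))))) = ⊥-elim (¬Ω₁z-y (Ω₁-sym i))
        midpointClass (inj₂ (inj₂ (inj₂ (inj₂ (inj₂ i))))) = ⊥-elim (¬Ω₁z (subst Ω₁ (x-0≡x z) i))

    declassify : Classes → GoodTriple 0# y z
    declassify (inj₁ ((Ω₁y , y≢0) , (z≢y , z≢0))) =
      (≢-sym y≢0 , ≢-sym z≢0 , ≢-sym z≢y) ,
      inj₂ (inj₂ (inj₂ (inj₁ (subst Ω₁ (sym (0-x≡-x y)) (Ω₁-neg Ω₁y)))))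
    declassify (inj₂ (inj₁ (¬Ω₁y , Ω₁z , z≢0))) =
      ((λ 0≡y → ¬Ω₁y (subst Ω₁ 0≡y Ω₁-0)) , ≢-sym z≢0 , (λ y≡z → ¬Ω₁y (subst Ω₁ (sym y≡z) Ω₁z))) ,
      inj₂ (inj₂ (inj₂ (inj₂ (inj₂ (subst Ω₁ (sym (x-0≡x z)) Ω₁z)))))
    declassify (inj₂ (inj₂ (inj₁ (¬Ω₁y , Ω₁z-y , z≢y)))) =
      ((λ 0≡y → ¬Ω₁y (subst Ω₁ 0≡y Ω₁-0)) ,
       (λ 0≡z → ¬Ω₁y (Ω₁-neg⁻ (subst Ω₁ (trans (cong (_- y) (sym 0≡z)) (0-x≡-x y)) Ω₁z-y))) , ≢-sym z≢y) ,
      inj₂ (inj₂ (inj₂ (inj₂ (inj₁ (Ω₁-sym Ω₁z-y)))))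
    declassify (inj₂ (inj₂ (inj₂ (inj₁ (¬Ω₂y , z≡-y))))) =
      ((λ 0≡y → ¬Ω₂y (subst Ω₂ 0≡y (Ω₁⇒Ω₂ Ω₁-0))) ,
       (λ 0≡z → ¬Ω₂y (subst Ω₂ (sym (-x≡0⇒x≡0 (trans (sym z≡-y) (sym 0≡z)))) (Ω₁⇒Ω₂ Ω₁-0))) ,
       (λ y≡z → ¬Ω₂y (Ω₁⇒Ω₂ (trans (cong (y +_) (trans y≡z z≡-y)) (inverseʳ y))))) ,
      inj₁ (trans (cong (y +_) z≡-y) (trans (inverseʳ y) (sym (identityʳ 0#))))
    declassify (inj₂ (inj₂ (inj₂ (inj₂ (inj₁ (¬Ω₂y , z≡2y)))))) =
      ((λ 0≡y → ¬Ω₂y (subst Ω₂ 0≡y (Ω₁⇒Ω₂ Ω₁-0))) ,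
       (λ 0≡z → ¬Ω₂y (Ω₁⇒Ω₂ (trans (sym z≡2y) (sym 0≡z)))) ,
       (λ y≡z → ¬Ω₂y (subst Ω₂ (sym (double≡self⇒0 (trans (sym z≡2y) (sym y≡z)))) (Ω₁⇒Ω₂ Ω₁-0)))) ,
      inj₂ (inj₁ (trans (identityʳ z) z≡2y))
    declassify (inj₂ (inj₂ (inj₂ (inj₂ (inj₂ (¬Ω₂z , y≡2z)))))) =
      ((λ 0≡y → ¬Ω₂z (Ω₁⇒Ω₂ (trans (sym y≡2z) (sym 0≡y)))) ,
       (λ 0≡z → ¬Ω₂z (subst Ω₂ 0≡z (Ω₁⇒Ω₂ Ω₁-0))) ,
       (λ y≡z → ¬Ω₂z (subst Ω₂ (sym (double≡self⇒0 (trans (sym y≡2z) y≡z))) (Ω₁⇒Ω₂ Ω₁-0)))) ,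
      inj₂ (inj₂ (inj₁ (trans (identityˡ y) y≡2z)))

    module _ (no-3-torsion : ∀ a → (a + a) + a ≡ 0# → a ≡ 0#) where
      private
        -≡double⇒0 : ∀ {a} → - a ≡ a + a → a ≡ 0#
        -≡double⇒0 {a} -a≡2a = no-3-torsion a (trans (cong (_+ a) (sym -a≡2a)) (inverseˡ a))

        0⇒Ω₂ : ∀ {a} → a ≡ 0# → Ω₂ a
        0⇒Ω₂ refl = Ω₁⇒Ω₂ Ω₁-0

      disjoint₅ : Class₅ → ¬ Class₆
      disjoint₅ (¬Ω₂y , z≡2y) (_ , y≡2z) = ¬Ω₂y (0⇒Ω₂ (no-3-torsion y (cancelʳ y (begin
        ((y + y) + y) + y ≡⟨ assoc (y + y) y y ⟩
        (y + y) + (y + y) ≡⟨ cong₂ _+_ (sym z≡2y) (sym z≡2y) ⟩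
        z + z             ≡⟨ sym y≡2z ⟩
        y                 ≡⟨ sym (identityˡ y) ⟩
        0# + y            ∎))))
        where open ≡-Reasoning

      disjoint₄ : Class₄ → ¬ (Class₅ ⊎ Class₆)
      disjoint₄ (¬Ω₂y , z≡-y) (inj₁ (_ , z≡2y))     = ¬Ω₂y (0⇒Ω₂ (-≡double⇒0 (trans (sym z≡-y) z≡2y)))
      disjoint₄ (¬Ω₂y , z≡-y) (inj₂ (¬Ω₂z , y≡2z)) =
        ¬Ω₂z (0⇒Ω₂ (-≡double⇒0 (trans (trans (cong -_ z≡-y) (-‿involutive y)) y≡2z)))

      disjoint₃ : Class₃ → ¬ (Class₄ ⊎ Class₅ ⊎ Class₆)
      disjoint₃ (¬Ω₁y , Ω₁z-y , _) (inj₁ (¬Ω₂y , z≡-y)) = ¬Ω₂y (Ω₁-neg⁻ (subst Ω₁ (z-y≡-[y+y] z≡-y) Ω₁z-y))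
      disjoint₃ (¬Ω₁y , Ω₁z-y , _) (inj₂ (inj₁ (_ , z≡2y))) = ¬Ω₁y (subst Ω₁ (trans (cong (_- y) z≡2y) (x+y-y≡x y y)) Ω₁z-y)
      disjoint₃ (¬Ω₁y , Ω₁z-y , _) (inj₂ (inj₂ (¬Ω₂z , y≡2z))) =
        ¬Ω₂z (Ω₁⇒Ω₂ (Ω₁-neg⁻ (subst Ω₁ (trans (cong (λ w → z - w) y≡2z) z-2z≡-z) Ω₁z-y)))
        where
          z-2z≡-z : z - (z + z) ≡ - z
          z-2z≡-z = trans (cong (z +_) (-‿+ z z)) (trans (sym (assoc z (- z) (- z))) (trans (cong (_+ - z) (inverseʳ z)) (identityˡ (- z))))

      disjoint₂ : Class₂ → ¬ (Class₃ ⊎ Class₄ ⊎ Class₅ ⊎ Class₆)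
      disjoint₂ (¬Ω₁y , Ω₁z , _) (inj₁ (_ , Ω₁z-y , _))              = ¬Ω₁y (Ω₁-cancel Ω₁z Ω₁z-y)
      disjoint₂ (¬Ω₁y , Ω₁z , _) (inj₂ (inj₁ (¬Ω₂y , z≡-y)))          = ¬Ω₂y (Ω₁⇒Ω₂ (Ω₁-neg⁻ (subst Ω₁ z≡-y Ω₁z)))
      disjoint₂ (¬Ω₁y , Ω₁z , _) (inj₂ (inj₂ (inj₁ (¬Ω₂y , z≡2y))))   = ¬Ω₂y (subst Ω₁ z≡2y Ω₁z)
      disjoint₂ (¬Ω₁y , Ω₁z , _) (inj₂ (inj₂ (inj₂ (¬Ω₂z , _))))      = ¬Ω₂z (Ω₁⇒Ω₂ Ω₁z)

      disjoint₁ : Class₁ → ¬ (Class₂ ⊎ Class₃ ⊎ Class₄ ⊎ Class₅ ⊎ Class₆)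
      disjoint₁ ((Ω₁y , _) , _) (inj₁ (¬Ω₁y , _))                          = ¬Ω₁y Ω₁y
      disjoint₁ ((Ω₁y , _) , _) (inj₂ (inj₁ (¬Ω₁y , _)))                   = ¬Ω₁y Ω₁y
      disjoint₁ ((Ω₁y , _) , _) (inj₂ (inj₂ (inj₁ (¬Ω₂y , _))))            = ¬Ω₂y (Ω₁⇒Ω₂ Ω₁y)
      disjoint₁ ((Ω₁y , _) , _) (inj₂ (inj₂ (inj₂ (inj₁ (¬Ω₂y , _)))))     = ¬Ω₂y (Ω₁⇒Ω₂ Ω₁y)
      disjoint₁ ((Ω₁y , _) , _) (inj₂ (inj₂ (inj₂ (inj₂ (¬Ω₂z , y≡2z)))))  = ¬Ω₂z (subst Ω₁ y≡2z Ω₁y)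

module Translation (A : FinAbGroup) where
  open import Data.Nat using (_+_; _*_)
  open import Data.Nat.Properties using (*-identityʳ)
  open import Data.Nat.Divisibility using (_∣_; divides)
  open import Data.Nat.Tactic.RingSolver using (solve-∀)
  open import Data.Fin using (toℕ)
  open import Data.Fin.Properties using (toℕ-injective)
  open import Data.Empty using (⊥-elim)
  open import Function.Base using (_∘_)
  open import Function.Bundles using (_↔_; mk↔ₛ′)
  open import Relation.Nullary using (¬_; yes; no)
  open import Relation.Binary.PropositionalEquality
  open import Algebra.Structures using (IsAbelianGroup)
  open FinAbGroup A using (Carrier; 0#; order; enum; isAbelianGroup) renaming (_+_ to _∔_)
  open IsAbelianGroup isAbelianGroup using (assoc; identityˡ; identityʳ)
  open Indicator
  open FiniteSum enum
  open GroupFacts A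
  open Arithmetic using (Least?; exactly-one-least)

  shift : Carrier → Carrier ↔ Carrier
  shift t = mk↔ₛ′ (_∔ t) (_- t) (λ x → x-y+y≡x x t) (λ x → x+y-y≡x x t)

  ∑-shift : ∀ t (f : Carrier → ℕ) → ∑ (λ x → f (x ∔ t)) ≡ ∑ f
  ∑-shift t = ∑-permute (shift t)

  module ElementOfOrder3 {a} (3a≡0 : (a ∔ a) ∔ a ≡ 0#) (a≢0 : a ≢ 0#) where
    open ≡-Reasoning
    idx : Carrier → ℕ
    idx u = toℕ (to u)

    -- u is counted iff it has the least index in its orbit {u, u + a, u + 2a}, so order = 3 · ∑ least.
    least : Carrier → ℕ
    least u = 𝟙 (Least? (idx u) (idx (u ∔ a)) (idx ((u ∔ a) ∔ a)))

    cycle : ∀ u → ((u ∔ a) ∔ a) ∔ a ≡ u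
    cycle u = trans (assoc (u ∔ a) a a) (trans (assoc u a (a ∔ a))
                (trans (cong (u ∔_) (trans (sym (assoc a a a)) 3a≡0)) (identityʳ u)))

    u≢u+a : ∀ u → u ≢ u ∔ a
    u≢u+a u u≡u+a = a≢0 (identityʳ-unique u a (sym u≡u+a))

    u≢u+2a : ∀ u → u ≢ (u ∔ a) ∔ a
    u≢u+2a u u≡u+2a = a≢0 (trans (sym (identityˡ a)) (trans (cong (_∔ a) (sym 2a≡0)) 3a≡0))
      where 2a≡0 = identityʳ-unique u (a ∔ a) (trans (sym (assoc u a a)) (sym u≡u+2a))

    idx-injective : ∀ {u w} → idx u ≡ idx w → u ≡ w
    idx-injective = to-injective ∘ toℕ-injective

    per-orbit : ∀ u → least u + least (u ∔ a) + least ((u ∔ a) ∔ a) ≡ 1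
    per-orbit u = begin
      least u + least (u ∔ a) + least ((u ∔ a) ∔ a)
        ≡⟨ cong₂ _+_ (cong (least u +_) (cong (λ m → 𝟙 (Least? j k m)) (cong idx (cycle u))))
                     (cong₂ (λ m m′ → 𝟙 (Least? k m m′)) (cong idx (cycle u)) (cong (idx ∘ (_∔ a)) (cycle u))) ⟩
      𝟙 (Least? i j k) + 𝟙 (Least? j k i) + 𝟙 (Least? k i j)
        ≡⟨ exactly-one-least (u≢u+a u ∘ idx-injective) (u≢u+2a u ∘ idx-injective) (u≢u+a (u ∔ a) ∘ idx-injective) ⟩
      1 ∎
      where
        i = idx u
        j = idx (u ∔ a)
        k = idx ((u ∔ a) ∔ a)

    triple : ∀ n → n + n + n ≡ n * 3
    triple = solve-∀

    order≡∑least*3 : order ≡ ∑ least * 3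
    order≡∑least*3 = begin
      order
        ≡⟨ sym (trans (∑-const 1) (*-identityʳ order)) ⟩
      ∑ (λ _ → 1)
        ≡⟨ sym (∑-cong per-orbit) ⟩
      ∑ (λ u → least u + least (u ∔ a) + least ((u ∔ a) ∔ a))
        ≡⟨ trans (∑-+ _ _) (cong (_+ ∑ (λ u → least ((u ∔ a) ∔ a))) (∑-+ _ _)) ⟩
      ∑ least + ∑ (λ u → least (u ∔ a)) + ∑ (λ u → least ((u ∔ a) ∔ a))
        ≡⟨ cong₂ _+_ (cong (∑ least +_) (∑-shift a least)) (trans (∑-shift a (least ∘ (_∔ a))) (∑-shift a least)) ⟩
      ∑ least + ∑ least + ∑ least
        ≡⟨ triple (∑ least) ⟩
      ∑ least * 3 ∎

  ¬3∣⇒no-3-torsion : ¬ 3 ∣ order → ∀ a → (a ∔ a) ∔ a ≡ 0# → a ≡ 0#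
  ¬3∣⇒no-3-torsion ¬3∣order a 3a≡0 with a ≟ 0#
  ... | yes a≡0 = a≡0
  ... | no a≢0  = ⊥-elim (¬3∣order (divides (∑ least) order≡∑least*3))
    where open ElementOfOrder3 3a≡0 a≢0

module TripleCount (A : FinAbGroup) where
  open import Data.Nat using (suc; _+_; _*_; _∸_)
  open import Data.Nat.Properties using (*-identityʳ; m+n∸m≡n)
  open import Data.Product using (_×_; _,_)
  open import Function.Base using (_∘_)
  open import Relation.Nullary using (¬_; Dec; ¬?)
  open import Relation.Nullary.Decidable using (_×-dec_; _⊎-dec_)
  open import Relation.Unary using (Decidable)
  open import Relation.Binary.PropositionalEquality
  open import Algebra.Structures using (IsAbelianGroup)
  open FinAbGroup A using (Carrier; 0#; -_; order; enum; isAbelianGroup) renaming (_+_ to _∔_)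
  open IsAbelianGroup isAbelianGroup using (identityˡ)
  open Indicator
  open FiniteSum enum
  open GroupFacts A
  open Shapes A
  open Translation A

  o₁ n₁ n₂ : ℕ
  o₁ = ∑ (λ x → 𝟙 (Ω₁? x ×-dec ¬? (x ≟ 0#)))
  n₁ = ∑ (λ x → 𝟙 (¬? (Ω₁? x)))
  n₂ = ∑ (λ x → 𝟙 (¬? (Ω₂? x)))

  ∑Ω₁≡1+o₁ : ∑ (λ x → 𝟙 (Ω₁? x)) ≡ suc o₁
  ∑Ω₁≡1+o₁ = ∑-remove Ω₁? Ω₁-0

  ∑∑ : (Carrier → Carrier → ℕ) → ℕ
  ∑∑ f = ∑ (λ y → ∑ (λ z → f y z))

  private
    ∑∑-+ : ∀ (f g : Carrier → Carrier → ℕ) → ∑∑ (λ y z → f y z + g y z) ≡ ∑∑ f + ∑∑ g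
    ∑∑-+ f g = trans (∑-cong (λ y → ∑-+ (f y) (g y))) (∑-+ _ _)

    ∑∑-×-const : ∀ {P : Carrier → Set} {Q : Carrier → Carrier → Set} (P? : Decidable P) (Q? : ∀ y z → Dec (Q y z)) {c} →
      (∀ y → P y → ∑ (λ z → 𝟙 (Q? y z)) ≡ c) → ∑∑ (λ y z → 𝟙 (P? y ×-dec Q? y z)) ≡ ∑ (λ y → 𝟙 (P? y)) * c
    ∑∑-×-const P? Q? {c} inner = begin
      ∑∑ (λ y z → 𝟙 (P? y ×-dec Q? y z))          ≡⟨ ∑-cong (λ y → trans (∑-cong (λ z → 𝟙-× (P? y) (Q? y z))) (∑-*ˡ (𝟙 (P? y)) _)) ⟩
      ∑ (λ y → 𝟙 (P? y) * ∑ (λ z → 𝟙 (Q? y z)))  ≡⟨ ∑-cong (λ y → 𝟙-*-cong (P? y) (inner y)) ⟩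
      ∑ (λ y → 𝟙 (P? y) * c)                      ≡⟨ ∑-*ʳ c _ ⟩
      ∑ (λ y → 𝟙 (P? y)) * c                      ∎
      where open ≡-Reasoning

    ∑∑-graph : ∀ {P : Carrier → Set} (P? : Decidable P) (g : Carrier → Carrier) →
      ∑∑ (λ y z → 𝟙 (P? y ×-dec z ≟ g y)) ≡ ∑ (λ y → 𝟙 (P? y))
    ∑∑-graph P? g = trans (∑∑-×-const P? (λ y z → z ≟ g y) (λ y _ → ∑-δ (g y))) (*-identityʳ _)

    ∑-avoid-two : ∀ {y} → y ≢ 0# → ∑ (λ z → 𝟙 (¬? (z ≟ y) ×-dec ¬? (z ≟ 0#))) ≡ order ∸ 2
    ∑-avoid-two {y} y≢0 = begin
      rest                                ≡⟨ sym (m+n∸m≡n 2 rest) ⟩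
      (1 + suc rest) ∸ 2                  ≡⟨ cong (λ m → (m + suc rest) ∸ 2) (sym (∑-δ y)) ⟩
      (∑ (λ z → 𝟙 (z ≟ y)) + suc rest) ∸ 2 ≡⟨ cong (λ m → (∑ (λ z → 𝟙 (z ≟ y)) + m) ∸ 2) (sym (∑-remove (λ z → ¬? (z ≟ y)) (≢-sym y≢0))) ⟩
      (∑ (λ z → 𝟙 (z ≟ y)) + ∑ (λ z → 𝟙 (¬? (z ≟ y)))) ∸ 2 ≡⟨ cong (_∸ 2) (∑-complement (_≟ y)) ⟩
      order ∸ 2                           ∎
      where
        open ≡-Reasoning
        rest = ∑ (λ z → 𝟙 (¬? (z ≟ y) ×-dec ¬? (z ≟ 0#)))

    ∑-Ω₁-diff : ∀ y → ∑ (λ z → 𝟙 (Ω₁? (z - y) ×-dec ¬? (z ≟ y))) ≡ o₁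
    ∑-Ω₁-diff y = trans (sym (∑-shift y _)) (∑-cong (λ w → 𝟙-cong (forth w) (back w) _ _))
      where
        forth : ∀ w → Ω₁ ((w ∔ y) - y) × w ∔ y ≢ y → Ω₁ w × w ≢ 0#
        forth w (Ω₁w , w+y≢y) = subst Ω₁ (x+y-y≡x w y) Ω₁w , λ w≡0 → w+y≢y (trans (cong (_∔ y) w≡0) (identityˡ y))
        back : ∀ w → Ω₁ w × w ≢ 0# → Ω₁ ((w ∔ y) - y) × w ∔ y ≢ y
        back w (Ω₁w , w≢0) = subst Ω₁ (sym (x+y-y≡x w y)) Ω₁w , λ w+y≡y → w≢0 (identityˡ-unique w y w+y≡y)

  open AtZero

  ∑∑-Class₁ : ∑∑ (λ y z → 𝟙 (Class₁? y z)) ≡ o₁ * (order ∸ 2)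
  ∑∑-Class₁ = ∑∑-×-const _ (λ y z → ¬? (z ≟ y) ×-dec ¬? (z ≟ 0#)) (λ y (_ , y≢0) → ∑-avoid-two y≢0)

  ∑∑-Class₂ : ∑∑ (λ y z → 𝟙 (Class₂? y z)) ≡ n₁ * o₁
  ∑∑-Class₂ = ∑∑-×-const (¬? ∘ Ω₁?) (λ y z → Ω₁? z ×-dec ¬? (z ≟ 0#)) (λ _ _ → refl)

  ∑∑-Class₃ : ∑∑ (λ y z → 𝟙 (Class₃? y z)) ≡ n₁ * o₁
  ∑∑-Class₃ = ∑∑-×-const (¬? ∘ Ω₁?) (λ y z → Ω₁? (z - y) ×-dec ¬? (z ≟ y)) (λ y _ → ∑-Ω₁-diff y)

  ∑∑-Class₄ : ∑∑ (λ y z → 𝟙 (Class₄? y z)) ≡ n₂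
  ∑∑-Class₄ = ∑∑-graph (¬? ∘ Ω₂?) (λ y → - y)

  ∑∑-Class₅ : ∑∑ (λ y z → 𝟙 (Class₅? y z)) ≡ n₂
  ∑∑-Class₅ = ∑∑-graph (¬? ∘ Ω₂?) (λ y → y ∔ y)

  ∑∑-Class₆ : ∑∑ (λ y z → 𝟙 (Class₆? y z)) ≡ n₂
  ∑∑-Class₆ = trans (∑-swap (λ y z → 𝟙 (Class₆? y z))) (∑∑-graph (¬? ∘ Ω₂?) (λ z → z ∔ z))

  module _ (no-3-torsion : ∀ a → (a ∔ a) ∔ a ≡ 0# → a ≡ 0#) where
    𝟙-GoodTriple-0 : ∀ y z → 𝟙 (GoodTriple? 0# y z)
      ≡ 𝟙 (Class₁? y z) + (𝟙 (Class₂? y z) + (𝟙 (Class₃? y z) + (𝟙 (Class₄? y z) + (𝟙 (Class₅? y z) + 𝟙 (Class₆? y z)))))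
    𝟙-GoodTriple-0 y z =
      trans (𝟙-cong (classify y z) (declassify y z) (GoodTriple? 0# y z) (c₁ ⊎-dec c₂ ⊎-dec c₃ ⊎-dec c₄ ⊎-dec c₅ ⊎-dec c₆))
      (trans (𝟙-⊎ (λ (c , cs) → disjoint₁ y z no-3-torsion c cs) c₁ _) (cong (𝟙 c₁ +_)
      (trans (𝟙-⊎ (λ (c , cs) → disjoint₂ y z no-3-torsion c cs) c₂ _) (cong (𝟙 c₂ +_)
      (trans (𝟙-⊎ (λ (c , cs) → disjoint₃ y z no-3-torsion c cs) c₃ _) (cong (𝟙 c₃ +_)
      (trans (𝟙-⊎ (λ (c , cs) → disjoint₄ y z no-3-torsion c cs) c₄ _) (cong (𝟙 c₄ +_)
      (𝟙-⊎ (λ (c , cs) → disjoint₅ y z no-3-torsion c cs) c₅ c₆)))))))))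
      where
        c₁ = Class₁? y z
        c₂ = Class₂? y z
        c₃ = Class₃? y z
        c₄ = Class₄? y z
        c₅ = Class₅? y z
        c₆ = Class₆? y z

    ∑∑-GoodTriple-0 : ∑∑ (λ y z → 𝟙 (GoodTriple? 0# y z)) ≡ o₁ * (order ∸ 2) + (n₁ * o₁ + (n₁ * o₁ + (n₂ + (n₂ + n₂))))
    ∑∑-GoodTriple-0 =
      trans (∑-cong (λ y → ∑-cong (λ z → 𝟙-GoodTriple-0 y z)))
      (trans (∑∑-+ _ _) (cong₂ _+_ ∑∑-Class₁
      (trans (∑∑-+ _ _) (cong₂ _+_ ∑∑-Class₂
      (trans (∑∑-+ _ _) (cong₂ _+_ ∑∑-Class₃
      (trans (∑∑-+ _ _) (cong₂ _+_ ∑∑-Class₄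
      (trans (∑∑-+ _ _) (cong₂ _+_ ∑∑-Class₅ ∑∑-Class₆))))))))))

  ∑∑∑-GoodTriple : ∑ (λ x → ∑∑ (λ y z → 𝟙 (GoodTriple? x y z))) ≡ order * ∑∑ (λ y z → 𝟙 (GoodTriple? 0# y z))
  ∑∑∑-GoodTriple = trans (∑-cong translate) (∑-const _)
    where
      translate : ∀ x → ∑∑ (λ y z → 𝟙 (GoodTriple? x y z)) ≡ ∑∑ (λ y z → 𝟙 (GoodTriple? 0# y z))
      translate x = begin
        ∑∑ (λ y z → 𝟙 (GoodTriple? x y z))
          ≡⟨ trans (sym (∑-shift x _)) (∑-cong (λ y → sym (∑-shift x _))) ⟩
        ∑∑ (λ y z → 𝟙 (GoodTriple? x (y ∔ x) (z ∔ x)))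
          ≡⟨ ∑-cong (λ y → ∑-cong (λ z → 𝟙-cong (GoodTriple-+⁻ x ∘ at-0+x) (from-0+x ∘ GoodTriple-+ x) _ _)) ⟩
        ∑∑ (λ y z → 𝟙 (GoodTriple? 0# y z)) ∎
        where
          open ≡-Reasoning
          at-0+x : ∀ {y z} → GoodTriple x y z → GoodTriple (0# ∔ x) y z
          at-0+x = subst (λ w → GoodTriple w _ _) (sym (identityˡ x))
          from-0+x : ∀ {y z} → GoodTriple (0# ∔ x) y z → GoodTriple x y z
          from-0+x = subst (λ w → GoodTriple w _ _) (identityˡ x)

module Orbits (A : FinAbGroup) where
  open import Data.Product using (∃-syntax; _×_; _,_)
  open import Data.Sum using (_⊎_; inj₁; inj₂)
  open import Data.List using ([]; _∷_)
  open import Data.List.Relation.Unary.Any using (Any; here; there; any?)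
  open import Function.Base using (_∘_)
  open import Function.Bundles using (_⇔_; mk⇔; Equivalence)
  open import Relation.Nullary using (Dec; ¬?)
  open import Relation.Nullary.Decidable using (_×-dec_; _⊎-dec_; _→-dec_; map′)
  open import Relation.Binary.PropositionalEquality
  open import Algebra.Structures using (IsAbelianGroup)
  open FinAbGroup A
  open IsAbelianGroup isAbelianGroup using (identityˡ)
  open Triple {Carrier}
  open FiniteSum enum using (_≟_; ∃?; ∀?; _∈X?_)
  import Function.Properties.Equivalence as ⇔
  open GroupFacts A
  open Shapes A

  Spans : SubsetA → Carrier → Carrier → Carrier → Set
  Spans T x y z = ∀ w → w ∈A T ⇔ OneOf x y z w

  Spans-rotate : ∀ {T x y z} → Spans T x y z → Spans T y z x
  Spans-rotate s w = mk⇔ (OneOf-rotate ∘ Equivalence.to (s w)) (Equivalence.from (s w) ∘ OneOf-rotate ∘ OneOf-rotate)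

  Spans-cong : ∀ {T x y z x′ y′ z′} → x ≡ x′ → y ≡ y′ → z ≡ z′ → Spans T x y z → Spans T x′ y′ z′
  Spans-cong refl refl refl s = s

  Spans⇒OneOf : ∀ {T x y z u p q} → Spans T u p q → Spans T x y z → ∀ {w} → OneOf u p q w → OneOf x y z w
  Spans⇒OneOf su sx {w} = Equivalence.to (sx w) ∘ Equivalence.from (su w)

  Any⇔OneOf : ∀ (f : Carrier → Carrier) {p q r w} → Any (λ y → w ≡ f y) (p ∷ q ∷ r ∷ []) ⇔ OneOf (f p) (f q) (f r) w
  Any⇔OneOf f = mk⇔ forth back
    where
      forth : ∀ {p q r w} → Any (λ y → w ≡ f y) (p ∷ q ∷ r ∷ []) → OneOf (f p) (f q) (f r) w
      forth (here e)                 = inj₁ e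
      forth (there (here e))         = inj₂ (inj₁ e)
      forth (there (there (here e))) = inj₂ (inj₂ e)
      back : ∀ {p q r w} → OneOf (f p) (f q) (f r) w → Any (λ y → w ≡ f y) (p ∷ q ∷ r ∷ [])
      back (inj₁ e)        = here e
      back (inj₂ (inj₁ e)) = there (here e)
      back (inj₂ (inj₂ e)) = there (there (here e))

  InOrbit⇒Spans : ∀ {T p q r} → InOrbit T (p ∷ q ∷ r ∷ []) →
    ∃[ c ] (Spans T (p + c) (q + c) (r + c) ⊎ Spans T (- p + c) (- q + c) (- r + c))
  InOrbit⇒Spans (c , inj₁ T⇔) = c , inj₁ (λ w → ⇔.trans (T⇔ w) (Any⇔OneOf (_+ c)))
  InOrbit⇒Spans (c , inj₂ T⇔) = c , inj₂ (λ w → ⇔.trans (T⇔ w) (Any⇔OneOf (λ y → - y + c)))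

  -- A reflected representative −{0, a, b} + c is the representative {0, −a, −b} + c, as − 0 = 0.
  InT⇒GoodSpan : ∀ {T} → InT1 T ⊎ InT2 T → ∃[ u ] ∃[ p ] ∃[ q ] (Spans T u p q × GoodTriple u p q)
  InT⇒GoodSpan (inj₁ (a , ¬Ω₁a , orbit)) with InOrbit⇒Spans orbit
  ... | c , inj₁ s = _ , _ , _ , s , GoodTriple-orbit₁ c ¬Ω₁a
  ... | c , inj₂ s = _ , _ , _ , Spans-cong (cong (_+ c) -0≡0) refl refl s , GoodTriple-orbit₁ c (¬Ω₁a ∘ Ω₁-neg⁻)
  InT⇒GoodSpan (inj₂ (a , h , a≢0 , Ω₁h , h≢0 , h≢a , orbit)) with InOrbit⇒Spans orbit
  ... | c , inj₁ s = _ , _ , _ , s , GoodTriple-orbit₂ c a≢0 h≢0 h≢a Ω₁h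
  ... | c , inj₂ s = _ , _ , _ , Spans-cong (cong (_+ c) -0≡0) refl refl s ,
                     GoodTriple-orbit₂ c (a≢0 ∘ -x≡0⇒x≡0) (h≢0 ∘ -x≡0⇒x≡0) (h≢a ∘ -‿injective) (Ω₁-neg Ω₁h)

  InT⇒Shape : ∀ {T x y z} → Spans T x y z → InT1 T ⊎ InT2 T → Shape x y z
  InT⇒Shape sx inT with InT⇒GoodSpan inT
  ... | u , p , q , su , (distinct , shape) =
    Shape-of-members distinct (member (inj₁ refl)) (member (inj₂ (inj₁ refl))) (member (inj₂ (inj₂ refl))) shape
    where member = Spans⇒OneOf su sx

  InT1-intro : ∀ {T c p q} → Spans T c p q → p ≢ q → Midpoint c p q → InT1 T
  InT1-intro {c = c} {p} s p≢q m =
    p - c , p≢q ∘ midpoint-Ω₁ m , c ,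
    inj₁ (λ w → ⇔.trans (Spans-cong (sym (identityˡ c)) (sym (x-y+y≡x p c)) (sym (midpoint-reflect m)) s w) (⇔.sym (Any⇔OneOf (_+ c))))

  InT2-intro : ∀ {T c s t} → Spans T c s t → c ≢ s → c ≢ t → s ≢ t → Ω₁ (t - c) → InT2 T
  InT2-intro {c = c} {s} {t} sp c≢s c≢t s≢t Ω₁t-c =
    s - c , t - c , c≢s ∘ sym ∘ x-y≡0⇒x≡y s c , Ω₁t-c , c≢t ∘ sym ∘ x-y≡0⇒x≡y t c , s≢t ∘ sym ∘ cancelʳ (- c) , c ,
    inj₁ (λ w → ⇔.trans (Spans-cong (sym (identityˡ c)) (sym (x-y+y≡x s c)) (sym (x-y+y≡x t c)) sp w) (⇔.sym (Any⇔OneOf (_+ c))))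

  Shape⇒InT : ∀ {T x y z} → Distinct x y z → Spans T x y z → Shape x y z → InT1 T ⊎ InT2 T
  Shape⇒InT (x≢y , x≢z , y≢z) s (inj₁ m)                             = inj₁ (InT1-intro s y≢z m)
  Shape⇒InT (x≢y , x≢z , y≢z) s (inj₂ (inj₁ m))                      = inj₁ (InT1-intro (Spans-rotate s) (x≢z ∘ sym) m)
  Shape⇒InT (x≢y , x≢z , y≢z) s (inj₂ (inj₂ (inj₁ m)))               = inj₁ (InT1-intro (Spans-rotate (Spans-rotate s)) x≢y m)
  Shape⇒InT (x≢y , x≢z , y≢z) s (inj₂ (inj₂ (inj₂ (inj₁ i))))        =
    inj₂ (InT2-intro (Spans-rotate s) y≢z (x≢y ∘ sym) (x≢z ∘ sym) i)
  Shape⇒InT (x≢y , x≢z , y≢z) s (inj₂ (inj₂ (inj₂ (inj₂ (inj₁ i))))) =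
    inj₂ (InT2-intro (Spans-rotate (Spans-rotate s)) (x≢z ∘ sym) (y≢z ∘ sym) x≢y i)
  Shape⇒InT (x≢y , x≢z , y≢z) s (inj₂ (inj₂ (inj₂ (inj₂ (inj₂ i))))) = inj₂ (InT2-intro s x≢y x≢z y≢z i)

  private
    _⇔?_ : ∀ {P Q : Set} → Dec P → Dec Q → Dec (P ⇔ Q)
    P? ⇔? Q? = map′ (λ (f , g) → mk⇔ f g) (λ e → Equivalence.to e , Equivalence.from e) ((P? →-dec Q?) ×-dec (Q? →-dec P?))

  InOrbit? : ∀ T xs → Dec (InOrbit T xs)
  InOrbit? T xs = ∃? (λ c → ∀? (λ w → (w ∈X? T) ⇔? any? (λ y → w ≟ y + c) xs)
                      ⊎-dec ∀? (λ w → (w ∈X? T) ⇔? any? (λ y → w ≟ - y + c) xs))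

  InT1? : ∀ T → Dec (InT1 T)
  InT1? T = ∃? (λ a → ¬? (Ω₁? a) ×-dec InOrbit? T (0# ∷ a ∷ - a ∷ []))

  InT2? : ∀ T → Dec (InT2 T)
  InT2? T = ∃? (λ a → ∃? (λ h → ¬? (a ≟ 0#) ×-dec Ω₁? h ×-dec ¬? (h ≟ 0#) ×-dec ¬? (h ≟ a) ×-dec InOrbit? T (0# ∷ a ∷ h ∷ [])))

module DoubleCount (A : FinAbGroup) where
  open import Data.Nat using (_+_; _*_; _∸_)
  open import Data.Nat.Properties using (*-identityˡ) renaming (_≟_ to _≟ℕ_)
  open import Data.Bool using () renaming (_≟_ to _≟𝔹_)
  open import Data.Vec.Properties using (≡-dec)
  open import Data.Fin.Subset using (∣_∣)
  open import Data.List using (filter)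
  open import Data.List.Membership.Propositional.Properties using (∈-filter⁻; ∈-filter⁺)
  open import Data.List.Relation.Unary.Unique.Propositional.Properties using (filter⁺)
  open import Data.Product using (_×_; _,_; proj₂)
  open import Data.Sum using (_⊎_; inj₁; inj₂)
  open import Function.Base using (_∘_)
  open import Function.Bundles using (_⇔_; mk⇔; Equivalence)
  open import Relation.Binary using (DecidableEquality)
  open import Relation.Nullary using (Dec)
  open import Relation.Nullary.Decidable using (_×-dec_; _⊎-dec_)
  open import Relation.Binary.PropositionalEquality using (_≡_; refl; sym; trans; cong)
  open FinAbGroup A using (Carrier; 0#; order; enum; SubsetA; InT1; InT2) renaming (_+_ to _∔_)
  open Indicator
  open ListSum
  open AllSubsets
  open Triple {Carrier}
  open FiniteSum enum
  open ThreeElementSubsets enum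
  open Shapes A using (GoodTriple; GoodTriple?)
  open Orbits A
  open TripleCount A using (o₁; n₁; n₂; ∑∑∑-GoodTriple; ∑∑-GoodTriple-0)

  Counted : SubsetA → Set
  Counted T = (∣ T ∣ ≡ 3) × (InT1 T ⊎ InT2 T)

  Counted? : ∀ T → Dec (Counted T)
  Counted? T = (∣ T ∣ ≟ℕ 3) ×-dec (InT1? T ⊎-dec InT2? T)

  N : ℕ
  N = ∑ˡ (subsets order) (λ T → 𝟙 (Counted? T))

  HasSize-Counted : HasSize N Counted
  HasSize-Counted =
    filter Counted? (subsets order) , filter⁺ Counted? (subsets-unique order) ,
    (λ T → mk⇔ (proj₂ ∘ ∈-filter⁻ Counted? {xs = subsets order}) (∈-filter⁺ Counted? (∈-subsets T))) ,
    length-filter≡∑ˡ Counted? (subsets order)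

  _≟ₛ_ : DecidableEquality SubsetA
  _≟ₛ_ = ≡-dec _≟𝔹_

  Counted×DistinctIn⇔≡⁅⁆×GoodTriple : ∀ T x y z → (Counted T × DistinctIn T x y z) ⇔ (⁅ x , y , z ⁆ ≡ T × GoodTriple x y z)
  Counted×DistinctIn⇔≡⁅⁆×GoodTriple T x y z = mk⇔ forth back
    where
      forth : Counted T × DistinctIn T x y z → ⁅ x , y , z ⁆ ≡ T × GoodTriple x y z
      forth ((∣T∣≡3 , inT) , dT@(d , x∈ , y∈ , z∈)) =
        ≡-by-members (λ w → ∈-OneOf w ∘ ∈⁅,,⁆⁻ w) (λ w → ∈⁅,,⁆⁺ w ∘ OfSize3.members T ∣T∣≡3 dT w) ,
        d , InT⇒Shape spans inT
        where
          ∈-OneOf : ∀ w → OneOf x y z w → w ∈X T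
          ∈-OneOf w (inj₁ refl)        = x∈
          ∈-OneOf w (inj₂ (inj₁ refl)) = y∈
          ∈-OneOf w (inj₂ (inj₂ refl)) = z∈
          spans : Spans T x y z
          spans w = mk⇔ (OfSize3.members T ∣T∣≡3 dT w) (∈-OneOf w)
      back : ⁅ x , y , z ⁆ ≡ T × GoodTriple x y z → Counted T × DistinctIn T x y z
      back (refl , d , shape) =
        (∣⁅,,⁆∣≡3 d , Shape⇒InT d (λ w → mk⇔ (∈⁅,,⁆⁻ w) (∈⁅,,⁆⁺ w)) shape) ,
        d , ∈⁅,,⁆⁺ x (inj₁ refl) , ∈⁅,,⁆⁺ y (inj₂ (inj₁ refl)) , ∈⁅,,⁆⁺ z (inj₂ (inj₂ refl))

  N*6≡∑∑∑GoodTriple : N * 6 ≡ ∑ (λ x → ∑ (λ y → ∑ (λ z → 𝟙 (GoodTriple? x y z))))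
  N*6≡∑∑∑GoodTriple = begin
    N * 6
      ≡⟨ sym (∑ˡ-*ʳ (subsets order) 6 _) ⟩
    ∑ˡ (subsets order) (λ T → 𝟙 (Counted? T) * 6)
      ≡⟨ ∑ˡ-cong (subsets order) ordered-triples ⟩
    ∑ˡ (subsets order) (λ T → ∑ (λ x → ∑ (λ y → ∑ (λ z → 𝟙 (Counted? T ×-dec DistinctIn? T x y z)))))
      ≡⟨ trans (∑ˡ-∑-swap (subsets order) _) (∑-cong (λ x → trans (∑ˡ-∑-swap (subsets order) _) (∑-cong (λ y → ∑ˡ-∑-swap (subsets order) _)))) ⟩
    ∑ (λ x → ∑ (λ y → ∑ (λ z → ∑ˡ (subsets order) (λ T → 𝟙 (Counted? T ×-dec DistinctIn? T x y z)))))
      ≡⟨ ∑-cong (λ x → ∑-cong (λ y → ∑-cong (λ z → spanned-once x y z))) ⟩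
    ∑ (λ x → ∑ (λ y → ∑ (λ z → 𝟙 (GoodTriple? x y z)))) ∎
    where
      open Relation.Binary.PropositionalEquality.≡-Reasoning
      ordered-triples : ∀ T → 𝟙 (Counted? T) * 6 ≡ ∑ (λ x → ∑ (λ y → ∑ (λ z → 𝟙 (Counted? T ×-dec DistinctIn? T x y z))))
      ordered-triples T = sym (begin
        ∑ (λ x → ∑ (λ y → ∑ (λ z → 𝟙 (Counted? T ×-dec DistinctIn? T x y z))))
          ≡⟨ ∑-cong (λ x → trans (∑-cong (λ y → trans (∑-cong (λ z → 𝟙-× (Counted? T) (DistinctIn? T x y z)))
                                                          (∑-*ˡ c (λ z → 𝟙 (DistinctIn? T x y z)))))
                                  (∑-*ˡ c (λ y → ∑ (λ z → 𝟙 (DistinctIn? T x y z))))) ⟩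
        ∑ (λ x → c * ∑ (λ y → ∑ (λ z → 𝟙 (DistinctIn? T x y z))))
          ≡⟨ ∑-*ˡ c (λ x → ∑ (λ y → ∑ (λ z → 𝟙 (DistinctIn? T x y z)))) ⟩
        c * ∑ (λ x → ∑ (λ y → ∑ (λ z → 𝟙 (DistinctIn? T x y z))))
          ≡⟨ 𝟙-*-cong (Counted? T) (λ (∣T∣≡3 , _) → OfSize3.∑-DistinctIn T ∣T∣≡3) ⟩
        c * 6 ∎)
        where c = 𝟙 (Counted? T)
      spanned-once : ∀ x y z → ∑ˡ (subsets order) (λ T → 𝟙 (Counted? T ×-dec DistinctIn? T x y z)) ≡ 𝟙 (GoodTriple? x y z)
      spanned-once x y z = begin
        ∑ˡ (subsets order) (λ T → 𝟙 (Counted? T ×-dec DistinctIn? T x y z))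
          ≡⟨ ∑ˡ-cong (subsets order) (λ T → 𝟙-cong (Equivalence.to (Counted×DistinctIn⇔≡⁅⁆×GoodTriple T x y z)) (Equivalence.from (Counted×DistinctIn⇔≡⁅⁆×GoodTriple T x y z)) _ _) ⟩
        ∑ˡ (subsets order) (λ T → 𝟙 ((⁅ x , y , z ⁆ ≟ₛ T) ×-dec GoodTriple? x y z))
          ≡⟨ trans (∑ˡ-cong (subsets order) (λ T → 𝟙-× (⁅ x , y , z ⁆ ≟ₛ T) _)) (∑ˡ-*ʳ (subsets order) _ _) ⟩
        ∑ˡ (subsets order) (λ T → 𝟙 (⁅ x , y , z ⁆ ≟ₛ T)) * 𝟙 (GoodTriple? x y z)
          ≡⟨ cong (_* 𝟙 (GoodTriple? x y z)) (∑ˡ-δ-∈ _≟ₛ_ (subsets-unique order) (∈-subsets ⁅ x , y , z ⁆)) ⟩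
        1 * 𝟙 (GoodTriple? x y z)
          ≡⟨ *-identityˡ _ ⟩
        𝟙 (GoodTriple? x y z) ∎

  N*6≡order*classes : (∀ a → (a ∔ a) ∔ a ≡ 0# → a ≡ 0#) →
    N * 6 ≡ order * (o₁ * (order ∸ 2) + (n₁ * o₁ + (n₁ * o₁ + (n₂ + (n₂ + n₂)))))
  N*6≡order*classes no-3-torsion =
    trans N*6≡∑∑∑GoodTriple (trans ∑∑∑-GoodTriple (cong (order *_) (∑∑-GoodTriple-0 no-3-torsion)))

open import Data.Nat using (_%_)
import Data.Nat as ℕ
open import Data.Integer using (ℤ; +_) renaming (_-_ to _-ℤ_; _*_ to _*ℤ_)
open import Data.Fin.Subset using (∣_∣)
open import Data.Product using (∃-syntax; _×_)
open import Data.Sum using (_⊎_)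
open import Relation.Binary.PropositionalEquality using (_≡_)

lemma4p8 : (A : FinAbGroup) → let open FinAbGroup A in
    (order % 6 ≡ 2 ⊎ order % 6 ≡ 4) →
    (ω₁ ω₂ : ℕ) →
    HasSize ω₁ (λ a → a + a ≡ 0#) →
    HasSize ω₂ (λ a → (a + a) + (a + a) ≡ 0#) →
    ∃[ N ] (HasSize N (λ (T : SubsetA) → (∣ T ∣ ≡ 3) × (InT1 T ⊎ InT2 T))
      × (+ 6) *ℤ (+ N) ≡ (+ 3) *ℤ (+ order) *ℤ (+ order) *ℤ (+ ω₁)
          -ℤ (+ order) *ℤ ((+ (2 ℕ.* ω₁ ℕ.* ω₁ ℕ.+ 3 ℕ.* ω₂)) -ℤ (+ 2)))
lemma4p8 A order%6 ω₁ ω₂ |Ω₁|≡ω₁ |Ω₂|≡ω₂ =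
  N , HasSize-Counted ,
  closed-form {N} {order} {ω₁} {ω₂} {o₁} {n₁} {n₂} (mod6⇒2≤ order%6) 1+o₁≡ω₁ ω₁+n₁≡order ω₂+n₂≡order
    (N*6≡order*classes no-3-torsion)
  where
    open import Data.Product using (_,_)
    open import Relation.Binary.PropositionalEquality using (sym; trans; cong)
    open FinAbGroup A using (order; enum; _+_; 0#)
    open FiniteSum enum using (HasSize⇒∑; ∑-complement)
    open GroupFacts A using (Ω₁?; Ω₂?)
    open Translation A using (¬3∣⇒no-3-torsion)
    open TripleCount A using (o₁; n₁; n₂; ∑Ω₁≡1+o₁)
    open DoubleCount A using (N; HasSize-Counted; N*6≡order*classes)
    open Arithmetic using (mod6⇒¬3∣; mod6⇒2≤; closed-form)

    no-3-torsion : ∀ a → (a + a) + a ≡ 0# → a ≡ 0#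
    no-3-torsion = ¬3∣⇒no-3-torsion (mod6⇒¬3∣ order%6)

    1+o₁≡ω₁ : ℕ.suc o₁ ≡ ω₁
    1+o₁≡ω₁ = sym (trans (HasSize⇒∑ Ω₁? |Ω₁|≡ω₁) ∑Ω₁≡1+o₁)

    ω₁+n₁≡order : ω₁ ℕ.+ n₁ ≡ order
    ω₁+n₁≡order = trans (cong (ℕ._+ n₁) (HasSize⇒∑ Ω₁? |Ω₁|≡ω₁)) (∑-complement Ω₁?)

    ω₂+n₂≡order : ω₂ ℕ.+ n₂ ≡ order
    ω₂+n₂≡order = trans (cong (ℕ._+ n₂) (HasSize⇒∑ Ω₂? |Ω₂|≡ω₂)) (∑-complement Ω₂?)
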